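{- Let $Q(x,y;z)=\sum_{i,j,k\ge0}q_{i,j,k}x^iy^jz^k=\sum_{i,j\ge0}q_{i,j}(z)x^iy^j$. Then, as formal power series in $z$ with coefficients polynomials in $x,y$ (each rational expression $\frac{1}{1-\gamma x}$ being expanded as $\sum_{i\ge0}\gamma^ix^i$), $$Q(x,y;z)=c+c\sum_{k=0}^{\infty}\left(\frac{1-\beta_k}{1-\beta_k y}\left[\frac{1-\alpha_k}{1-\alpha_k x}-\frac{1-\alpha_{k+1}}{1-\alpha_{k+1}x}\right]+\frac{1-\beta_k}{1-\beta_k x}\left[\frac{1-\alpha_k}{1-\alpha_k y}-\frac{1-\alpha_{k+1}}{1-\alpha_{k+1}y}\right]\right),$$ with $c=1/(1-2z+z\widehat{x}_{0,0})$. Furthermore, $$Q(0,0;z)=c(1+\widehat{x}_{0,0}),\qquad Q(1,0;z)=Q(0,1;z)=c(1-\alpha_0(z)),\qquad Q(1,1;z)=c,$$ where $Q(1,0;z)=\sum_{i}q_{i,0}(z)$, $Q(0,1;z)=\sum_j q_{0,j}(z)$, $Q(1,1;z)=\sum_{i,j}q_{i,j}(z)$.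
   Context: For integers $i,j,k\ge0$, let $q_{i,j,k}$ be defined by $q_{0,0,0}=1$, $q_{i,j,0}=0$ for $i+j>0$, and for all $k\ge0$: $q_{i,j,k+1}=q_{i-1,j+1,k}+q_{i+1,j-1,k}+q_{i+1,j+1,k}$ for $i,j\ge1$; $q_{i,0,k+1}=q_{i-1,1,k}+q_{i+1,1,k}+q_{i-1,0,k}+q_{i+1,0,k}$ for $i\ge1$; $q_{0,j,k+1}=q_{1,j-1,k}+q_{1,j+1,k}+q_{0,j-1,k}+q_{0,j+1,k}$ for $j\ge1$; $q_{0,0,k+1}=q_{0,1,k}+q_{1,1,k}+q_{1,0,k}$. (Combinatorially, $q_{i,j,k}$ is the number of walks of length $k$ in $\mathbb{Z}_+^2$ from $(0,0)$ to $(i,j)$ using steps $\{(-1,1),(-1,-1),(1,-1)\}$ from interior points, $\{(-1,1),(-1,0),(1,0)\}$ from points $(i,0)$, $i\ge1$, $\{(0,1),(0,-1),(1,-1)\}$ from points $(0,j)$, $j\ge1$, and $\{(0,1),(1,0)\}$ from $(0,0)$.) Let $q_{i,j}(z)=\sum_{k\ge0}q_{i,j,k}z^k$. Formal series: for $u$ with zero constant term, $\sqrt{1-u}$ is the formal square root with constant term $1$. $\alpha_0=\frac{1-\sqrt{1-8z^2}}{4z}$, $\beta_0=\frac{\alpha_0^2}{1+\alpha_0^2}$, $f(t)=\frac{1-\sqrt{1-4z^{2}(1+t^2)}}{2z(1+t^2)}\,t$, $\alpha_{k+1}=f(\beta_k)$ ($k\ge0$), $\beta_k=f(\alpha_k)$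 ($k\ge1$). $x_{i,j}=\sum_{k\ge0}(1-\beta_k)\beta_k^j[(1-\alpha_k)\alpha_k^i-(1-\alpha_{k+1})\alpha_{k+1}^i]$ with $\alpha^0=\beta^0=1$, and $\widehat{x}_{i,j}=x_{i,j}+x_{j,i}$. -}

module Defs where

open import Data.Nat as ℕ using (ℕ; zero; suc; _∸_)
open import Data.Integer using (+_)
open import Data.Rational as ℚ using (ℚ; 0ℚ; 1ℚ; _≟_; _/_; 1/_; ≢-nonZero)
open import Data.List using (List; []; _∷_; _++_)
open import Data.Product using (_×_; _,_; proj₁; proj₂)
open import Relation.Nullary using (yes; no)
open import Relation.Binary.PropositionalEquality using (_≡_)

q : ℕ → ℕ → ℕ → ℕ
q zero    zero    zero    = 1
q _       _       zero    = 0
q (suc i) (suc j) (suc k) =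
  q i (suc (suc j)) k ℕ.+ q (suc (suc i)) j k ℕ.+ q (suc (suc i)) (suc (suc j)) k
q (suc i) zero    (suc k) =
  q i 1 k ℕ.+ q (suc (suc i)) 1 k ℕ.+ q i 0 k ℕ.+ q (suc (suc i)) 0 k
q zero    (suc j) (suc k) =
  q 1 j k ℕ.+ q 1 (suc (suc j)) k ℕ.+ q 0 j k ℕ.+ q 0 (suc (suc j)) k
q zero    zero    (suc k) = q 0 1 k ℕ.+ q 1 1 k ℕ.+ q 1 0 k

Series : Set
Series = ℕ → ℚ

infix 4 _≈_
_≈_ : Series → Series → Set
a ≈ b = ∀ n → a n ≡ b n

sumLt : ℕ → (ℕ → ℚ) → ℚ
sumLt zero    f = 0ℚ
sumLt (suc n) f = sumLt n f ℚ.+ f n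

sumLe : ℕ → (ℕ → ℚ) → ℚ
sumLe n f = sumLt (suc n) f

const : ℚ → Series
const c zero    = c
const c (suc _) = 0ℚ

zS : Series
zS 1 = 1ℚ
zS _ = 0ℚ

infixl 6 _⊕_ _⊖_
infixl 7 _⊛_

_⊕_ : Series → Series → Series
(a ⊕ b) n = a n ℚ.+ b n

_⊖_ : Series → Series → Series
(a ⊖ b) n = a n ℚ.- b n

_⊛_ : Series → Series → Series
(a ⊛ b) n = sumLe n (λ m → a m ℚ.* b (n ∸ m))

pow : Series → ℕ → Series
pow a zero    = const 1ℚ
pow a (suc k) = a ⊛ pow a k

-- division by z (used only on series with zero constant term)
divZ : Series → Series
divZ a n = a (suc n)

-- sequences defined by course-of-values recursion
at : List ℚ → ℕ → ℚ
at []       _       = 0ℚ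
at (x ∷ xs) zero    = x
at (x ∷ xs) (suc m) = at xs m

prefix : ((ℕ → ℚ) → ℕ → ℚ) → ℕ → List ℚ
prefix step zero    = []
prefix step (suc n) = prefix step n ++ (step (at (prefix step n)) n ∷ [])

build : ((ℕ → ℚ) → ℕ → ℚ) → Series
build step n = at (prefix step (suc n)) n

-- reciprocal of a rational (only used on nonzero arguments)
recip : ℚ → ℚ
recip p with p ≟ 0ℚ
... | yes _  = 0ℚ
... | no p≢0 = 1/_ p {{≢-nonZero p≢0}}

-- multiplicative inverse 1/a of a series with nonzero constant term
inv : Series → Series
inv a = build step
  where
  r = recip (a 0)
  step : (ℕ → ℚ) → ℕ → ℚ
  step b zero    = r
  step b (suc n) = ℚ.- (r ℚ.* sumLe n (λ m → a (suc m) ℚ.* b (n ∸ m)))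

-- formal square root √(1-u) with constant term 1 (u has zero constant term)
sqrt1m : Series → Series
sqrt1m u = build step
  where
  step : (ℕ → ℚ) → ℕ → ℚ
  step s zero    = 1ℚ
  step s (suc n) =
    (ℚ.- u (suc n) ℚ.- sumLt n (λ m → s (suc m) ℚ.* s (n ∸ m))) ℚ.* (+ 1 / 2)

one : Series
one = const 1ℚ

α₀ : Series
α₀ = divZ (one ⊖ sqrt1m (const (+ 8 / 1) ⊛ zS ⊛ zS)) ⊛ const (+ 1 / 4)

β₀ : Series
β₀ = pow α₀ 2 ⊛ inv (one ⊕ pow α₀ 2)

f : Series → Series
f t = divZ (one ⊖ sqrt1m (const (+ 4 / 1) ⊛ zS ⊛ zS ⊛ (one ⊕ pow t 2)))
      ⊛ inv (const (+ 2 / 1) ⊛ (one ⊕ pow t 2)) ⊛ t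

αβ : ℕ → Series × Series
αβ zero    = α₀ , β₀
αβ (suc k) = f (proj₂ (αβ k)) , f (f (proj₂ (αβ k)))

α β : ℕ → Series
α k = proj₁ (αβ k)
β k = proj₂ (αβ k)

xTerm : ℕ → ℕ → ℕ → Series
xTerm k i j = (one ⊖ β k) ⊛ pow (β k) j
  ⊛ ((one ⊖ α k) ⊛ pow (α k) i ⊖ (one ⊖ α (suc k)) ⊛ pow (α (suc k)) i)

-- formal sum Σ_{k≥0} s_k of series with val(s_k) ≥ k+1 (true for all
-- summands used here): [z^n] Σ_k s_k = Σ_{k≤n} [z^n] s_k
sumSeries : (ℕ → Series) → Series
sumSeries s n = sumLe n (λ k → s k n)

x : ℕ → ℕ → Series
x i j = sumSeries (λ k → xTerm k i j)

x̂ : ℕ → ℕ → Series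
x̂ i j = x i j ⊕ x j i

c : Series
c = inv (one ⊖ const (+ 2 / 1) ⊛ zS ⊕ zS ⊛ x̂ 0 0)

qS : ℕ → ℕ → Series
qS i j n = + q i j n / 1

δ00 : ℕ → ℕ → Series
δ00 zero zero = one
δ00 _    _    = const 0ℚ

-- [x^i y^j] of the k-th summand of the sum in the theorem
rhsTerm : ℕ → ℕ → ℕ → Series
rhsTerm k i j = xTerm k i j ⊕ xTerm k j i

-- Q(1,0;z) = Σ_i q_{i,0}(z);  q_{i,j,n} = 0 unless i,j ≤ n
Q10 Q01 Q11 : Series
Q10 n = sumLe n (λ i → + q i 0 n / 1)
Q01 n = sumLe n (λ j → + q 0 j n / 1)
Q11 n = sumLe n (λ i → sumLe n (λ j → + q i j n / 1))

{-# OPTIONS --safe #-}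
module Submission where

-- The kernel of the walk is K(x, y) = x y − z (x² + y² + x² y²).  Whenever
-- K(x, y) = 0, the product family (1 − x)(1 − y) xⁱ yʲ satisfies the
-- recursion of q at every interior point, and on the first row it fails only
-- by (1 − x) xⁱ (x − z − 2 z x²), symmetrically on the first column.  The
-- pairs (α_k, β_k) and (α_{k+1}, β_k) lie on the kernel, so in the sum over k
-- defining the candidate these failures telescope: the one of α₀ vanishes
-- because α₀ is the small root of 2 z α² − α + z, and since α_k → 0 the limit
-- term leaves exactly z at (1, 0) and (0, 1), the contribution of the initial
-- point.  At the origin a failure −2z remains, which the factor
-- c = 1/(1 − 2z + z x̂₀₀) absorbs, so candidate and q satisfy the same
-- recursion with the same initial value.  For the specialisations, all α_k, β_k
-- have zero constant term, so Σᵢ (1 − x) xⁱ is 1 to any given order: each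
-- product family sums to 1, and the sum over k telescopes or cancels.

open import Defs
open import Data.Nat as ℕ using (ℕ; zero; suc; _∸_; z≤n; s≤s)
import Data.Nat.Properties as ℕP
open import Data.Integer using (+_)
import Data.Integer as ℤ
import Data.Integer.Properties as ℤP
import Data.Nat.Coprimality as Coprime
open import Data.Rational as ℚ using (ℚ; 0ℚ; 1ℚ; ½; mkℚ)
import Data.Rational.Properties as ℚP
open import Data.Rational.Solver using (module +-*-Solver)
open import Data.List using (List; []; _∷_; _++_; length)
import Data.List.Properties as ListP
open import Data.Maybe using (Maybe; just; nothing)
open import Data.Product using (_×_; _,_; proj₁; proj₂)
open import Data.Sum using (inj₁; inj₂)
open import Data.Empty using (⊥-elim)
open import Function using (_∘_)
open import Relation.Nullary using (yes; no)
open import Relation.Binary.PropositionalEquality hiding (J)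
open import Relation.Binary.Bundles using (Setoid)
import Relation.Binary.Reasoning.Setoid
open import Algebra.Bundles using (CommutativeRing)
import Algebra.Solver.Ring.AlmostCommutativeRing as ACR
import Algebra.Solver.Ring

module ℚS = +-*-Solver

sumLt-cong-< : ∀ n {f g : ℕ → ℚ} → (∀ m → m ℕ.< n → f m ≡ g m) → sumLt n f ≡ sumLt n g
sumLt-cong-< zero    h = refl
sumLt-cong-< (suc n) h =
  cong₂ ℚ._+_ (sumLt-cong-< n (λ m m<n → h m (ℕP.m<n⇒m<1+n m<n))) (h n ℕP.≤-refl)

sumLt-cong : ∀ n {f g : ℕ → ℚ} → (∀ m → f m ≡ g m) → sumLt n f ≡ sumLt n g
sumLt-cong n h = sumLt-cong-< n (λ m _ → h m)

sumLt-+ : ∀ n (f g : ℕ → ℚ) → sumLt n (λ m → f m ℚ.+ g m) ≡ sumLt n f ℚ.+ sumLt n g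
sumLt-+ zero    f g = refl
sumLt-+ (suc n) f g =
  trans (cong (ℚ._+ (f n ℚ.+ g n)) (sumLt-+ n f g)) (interchange (sumLt n f) (sumLt n g) (f n) (g n))
  where
  open ℚS
  interchange : ∀ a b c d → (a ℚ.+ b) ℚ.+ (c ℚ.+ d) ≡ (a ℚ.+ c) ℚ.+ (b ℚ.+ d)
  interchange = solve 4 (λ a b c d → (a :+ b) :+ (c :+ d) := (a :+ c) :+ (b :+ d)) refl

sumLt-zero : ∀ n → sumLt n (λ _ → 0ℚ) ≡ 0ℚ
sumLt-zero zero    = refl
sumLt-zero (suc n) = trans (ℚP.+-identityʳ _) (sumLt-zero n)

sumLt-*ˡ : ∀ n p (f : ℕ → ℚ) → sumLt n (λ m → p ℚ.* f m) ≡ p ℚ.* sumLt n f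
sumLt-*ˡ zero    p f = sym (ℚP.*-zeroʳ p)
sumLt-*ˡ (suc n) p f = trans (cong (ℚ._+ (p ℚ.* f n)) (sumLt-*ˡ n p f)) (sym (ℚP.*-distribˡ-+ p _ _))

sumLt-*ʳ : ∀ n p (f : ℕ → ℚ) → sumLt n (λ m → f m ℚ.* p) ≡ sumLt n f ℚ.* p
sumLt-*ʳ zero    p f = sym (ℚP.*-zeroˡ p)
sumLt-*ʳ (suc n) p f = trans (cong (ℚ._+ (f n ℚ.* p)) (sumLt-*ʳ n p f)) (sym (ℚP.*-distribʳ-+ p (sumLt n f) (f n)))

sumLt-neg : ∀ n (f : ℕ → ℚ) → sumLt n (λ m → ℚ.- f m) ≡ ℚ.- sumLt n f
sumLt-neg zero    f = refl
sumLt-neg (suc n) f = trans (cong (ℚ._+ (ℚ.- f n)) (sumLt-neg n f)) (sym (ℚP.neg-distrib-+ (sumLt n f) (f n)))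

sumLt-- : ∀ n (f g : ℕ → ℚ) → sumLt n (λ m → f m ℚ.- g m) ≡ sumLt n f ℚ.- sumLt n g
sumLt-- n f g = trans (sumLt-+ n f (λ m → ℚ.- g m)) (cong (sumLt n f ℚ.+_) (sumLt-neg n g))

sumLt-suc : ∀ n (f : ℕ → ℚ) → sumLt (suc n) f ≡ f 0 ℚ.+ sumLt n (f ∘ suc)
sumLt-suc zero    f = trans (ℚP.+-identityˡ (f 0)) (sym (ℚP.+-identityʳ (f 0)))
sumLt-suc (suc n) f =
  trans (cong (ℚ._+ f (suc n)) (sumLt-suc n f)) (ℚP.+-assoc (f 0) (sumLt n (f ∘ suc)) (f (suc n)))

sumLe-reverse : ∀ n (f : ℕ → ℚ) → sumLe n f ≡ sumLe n (λ m → f (n ∸ m))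
sumLe-reverse zero    f = refl
sumLe-reverse (suc n) f = begin
  sumLe n f ℚ.+ f (suc n)                  ≡⟨ cong (ℚ._+ f (suc n)) (sumLe-reverse n f) ⟩
  sumLe n (λ m → f (n ∸ m)) ℚ.+ f (suc n)  ≡⟨ ℚP.+-comm _ (f (suc n)) ⟩
  f (suc n) ℚ.+ sumLe n (λ m → f (n ∸ m))  ≡⟨ sym (sumLt-suc (suc n) (λ m → f (suc n ∸ m))) ⟩
  sumLe (suc n) (λ m → f (suc n ∸ m))      ∎
  where open ≡-Reasoning

sumLt-swap : ∀ n k (F : ℕ → ℕ → ℚ) →
  sumLt n (λ i → sumLt k (F i)) ≡ sumLt k (λ j → sumLt n (λ i → F i j))
sumLt-swap zero    k F = sym (sumLt-zero k)
sumLt-swap (suc n) k F = trans (cong (ℚ._+ sumLt k (F n)) (sumLt-swap n k F)) (sym (sumLt-+ k _ _))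

sumLe-triangle : ∀ n (F : ℕ → ℕ → ℚ) →
  sumLe n (λ m → sumLe m (λ p → F p m)) ≡ sumLe n (λ p → sumLe (n ∸ p) (λ r → F p (p ℕ.+ r)))
sumLe-triangle zero    F = refl
sumLe-triangle (suc n) F = begin
  sumLe n (λ m → sumLe m (λ p → F p m)) ℚ.+ sumLe (suc n) (λ p → F p (suc n))
    ≡⟨ cong (ℚ._+ sumLe (suc n) (λ p → F p (suc n))) (sumLe-triangle n F) ⟩
  A ℚ.+ (sumLe n (λ p → F p (suc n)) ℚ.+ F (suc n) (suc n))
    ≡⟨ sym (ℚP.+-assoc A _ _) ⟩
  (A ℚ.+ sumLe n (λ p → F p (suc n))) ℚ.+ F (suc n) (suc n)
    ≡⟨ cong₂ ℚ._+_ (sym (sumLt-+ (suc n) _ _)) (sym (ℚP.+-identityˡ _)) ⟩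
  sumLe n (λ p → sumLe (n ∸ p) (λ r → F p (p ℕ.+ r)) ℚ.+ F p (suc n)) ℚ.+ (0ℚ ℚ.+ F (suc n) (suc n))
    ≡⟨ cong₂ ℚ._+_ (sumLt-cong-< (suc n) extend-row) (sym (last-row (suc n) (F (suc n)))) ⟩
  sumLe n (λ p → sumLe (suc n ∸ p) (λ r → F p (p ℕ.+ r)))
    ℚ.+ sumLe (suc n ∸ suc n) (λ r → F (suc n) (suc n ℕ.+ r))
    ∎
  where
  open ≡-Reasoning
  A = sumLe n (λ p → sumLe (n ∸ p) (λ r → F p (p ℕ.+ r)))
  last-row : ∀ m (G : ℕ → ℚ) → sumLe (m ∸ m) (λ r → G (m ℕ.+ r)) ≡ 0ℚ ℚ.+ G m
  last-row m G rewrite ℕP.n∸n≡0 m | ℕP.+-identityʳ m = refl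
  extend-row : ∀ p → p ℕ.< suc n →
    sumLe (n ∸ p) (λ r → F p (p ℕ.+ r)) ℚ.+ F p (suc n) ≡ sumLe (suc n ∸ p) (λ r → F p (p ℕ.+ r))
  extend-row p (s≤s p≤n) rewrite ℕP.+-∸-assoc 1 p≤n =
    cong (λ t → sumLe (n ∸ p) (λ r → F p (p ℕ.+ r)) ℚ.+ F p t)
         (sym (trans (ℕP.+-suc p (n ∸ p)) (cong suc (ℕP.m+[n∸m]≡n p≤n))))

sumLe-pad : ∀ m N (f : ℕ → ℚ) → (∀ k → m ℕ.< k → f k ≡ 0ℚ) → m ℕ.≤ N → sumLe m f ≡ sumLe N f
sumLe-pad m zero    f zeros z≤n = refl
sumLe-pad m (suc N) f zeros m≤1+N with ℕP.m≤n⇒m<n∨m≡n m≤1+N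
... | inj₂ refl  = refl
... | inj₁ m<1+N = trans (sumLe-pad m N f zeros (ℕP.≤-pred m<1+N))
  (trans (sym (ℚP.+-identityʳ _)) (cong (sumLe N f ℚ.+_) (sym (zeros (suc N) m<1+N))))

-- The ring of formal power series

0ₛ : Series
0ₛ = const 0ℚ

neg : Series → Series
neg a n = ℚ.- a n

0ₛ-coeff : ∀ n → 0ₛ n ≡ 0ℚ
0ₛ-coeff zero    = refl
0ₛ-coeff (suc n) = refl

-- Wrapping _≈_ in a record makes both series recoverable from the type,
-- which implicit-argument inference and the ring solver rely on.
infix 4 _≋_
record _≋_ (a b : Series) : Set where
  constructor ⟪_⟫
  field ap : a ≈ b
open _≋_ public

≋-refl : ∀ {a} → a ≋ a
≋-refl = ⟪ (λ n → refl) ⟫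

≋-sym : ∀ {a b} → a ≋ b → b ≋ a
≋-sym ⟪ p ⟫ = ⟪ (λ n → sym (p n)) ⟫

≋-trans : ∀ {a b c} → a ≋ b → b ≋ c → a ≋ c
≋-trans ⟪ p ⟫ ⟪ q ⟫ = ⟪ (λ n → trans (p n) (q n)) ⟫

≋-setoid : Setoid _ _
≋-setoid = record
  { Carrier = Series ; _≈_ = _≋_
  ; isEquivalence = record { refl = ≋-refl ; sym = ≋-sym ; trans = ≋-trans } }

module ≋-Reasoning = Relation.Binary.Reasoning.Setoid ≋-setoid

⊕-cong : ∀ {a a′ b b′} → a ≋ a′ → b ≋ b′ → a ⊕ b ≋ a′ ⊕ b′
⊕-cong ⟪ p ⟫ ⟪ q ⟫ = ⟪ (λ n → cong₂ ℚ._+_ (p n) (q n)) ⟫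

⊖-cong : ∀ {a a′ b b′} → a ≋ a′ → b ≋ b′ → a ⊖ b ≋ a′ ⊖ b′
⊖-cong ⟪ p ⟫ ⟪ q ⟫ = ⟪ (λ n → cong₂ ℚ._-_ (p n) (q n)) ⟫

neg-cong : ∀ {a a′} → a ≋ a′ → neg a ≋ neg a′
neg-cong ⟪ p ⟫ = ⟪ (λ n → cong ℚ.-_ (p n)) ⟫

⊛-cong : ∀ {a a′ b b′} → a ≋ a′ → b ≋ b′ → a ⊛ b ≋ a′ ⊛ b′
⊛-cong ⟪ p ⟫ ⟪ q ⟫ = ⟪ (λ n → sumLt-cong (suc n) (λ m → cong₂ ℚ._*_ (p m) (q (n ∸ m)))) ⟫

⊕-congˡ : ∀ {a a′} b → a ≋ a′ → a ⊕ b ≋ a′ ⊕ b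
⊕-congˡ {a} {a′} b p = ⊕-cong {a} {a′} {b} {b} p ≋-refl

⊕-congʳ : ∀ a {b b′} → b ≋ b′ → a ⊕ b ≋ a ⊕ b′
⊕-congʳ a {b} {b′} p = ⊕-cong {a} {a} {b} {b′} ≋-refl p

⊖-congˡ : ∀ {a a′} b → a ≋ a′ → a ⊖ b ≋ a′ ⊖ b
⊖-congˡ {a} {a′} b p = ⊖-cong {a} {a′} {b} {b} p ≋-refl

⊖-congʳ : ∀ a {b b′} → b ≋ b′ → a ⊖ b ≋ a ⊖ b′
⊖-congʳ a {b} {b′} p = ⊖-cong {a} {a} {b} {b′} ≋-refl p

⊛-congˡ : ∀ {a a′} b → a ≋ a′ → a ⊛ b ≋ a′ ⊛ b
⊛-congˡ {a} {a′} b p = ⊛-cong {a} {a′} {b} {b} p ≋-refl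

⊛-congʳ : ∀ a {b b′} → b ≋ b′ → a ⊛ b ≋ a ⊛ b′
⊛-congʳ a {b} {b′} p = ⊛-cong {a} {a} {b} {b′} ≋-refl p

⊛-comm : ∀ a b → a ⊛ b ≋ b ⊛ a
⊛-comm a b = ⟪ (λ n → trans (sumLe-reverse n _) (sumLt-cong-< (suc n) (λ m m≤n →
  trans (cong (λ t → a (n ∸ m) ℚ.* b t) (ℕP.m∸[m∸n]≡n (ℕP.≤-pred m≤n))) (ℚP.*-comm (a (n ∸ m)) (b m))))) ⟫

⊛-distribˡ-⊕ : ∀ a b c → a ⊛ (b ⊕ c) ≋ a ⊛ b ⊕ a ⊛ c
⊛-distribˡ-⊕ a b c = ⟪ (λ n →
  trans (sumLt-cong (suc n) (λ m → ℚP.*-distribˡ-+ (a m) (b (n ∸ m)) (c (n ∸ m)))) (sumLt-+ (suc n) _ _)) ⟫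

⊛-distribʳ-⊕ : ∀ a b c → (b ⊕ c) ⊛ a ≋ b ⊛ a ⊕ c ⊛ a
⊛-distribʳ-⊕ a b c = ≋-trans (⊛-comm (b ⊕ c) a)
  (≋-trans (⊛-distribˡ-⊕ a b c) (⊕-cong (⊛-comm a b) (⊛-comm a c)))

const-⊛-coeff : ∀ p a n → (const p ⊛ a) n ≡ p ℚ.* a n
const-⊛-coeff p a n = begin
  sumLe n (λ m → const p m ℚ.* a (n ∸ m))             ≡⟨ sumLt-suc n _ ⟩
  p ℚ.* a n ℚ.+ sumLt n (λ m → 0ℚ ℚ.* a (n ∸ suc m))  ≡⟨ cong (p ℚ.* a n ℚ.+_) (trans
                                                          (sumLt-cong n (λ m → ℚP.*-zeroˡ (a (n ∸ suc m))))
                                                          (sumLt-zero n)) ⟩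
  p ℚ.* a n ℚ.+ 0ℚ                                     ≡⟨ ℚP.+-identityʳ _ ⟩
  p ℚ.* a n                                            ∎
  where open ≡-Reasoning

one-⊛ : ∀ a → one ⊛ a ≋ a
one-⊛ a = ⟪ (λ n → trans (const-⊛-coeff 1ℚ a n) (ℚP.*-identityˡ (a n))) ⟫

⊛-one : ∀ a → a ⊛ one ≋ a
⊛-one a = ≋-trans (⊛-comm a one) (one-⊛ a)

⊛-assoc : ∀ a b c → (a ⊛ b) ⊛ c ≋ a ⊛ (b ⊛ c)
⊛-assoc a b c = ⟪ (λ n → begin
  sumLe n (λ m → sumLe m (λ p → a p ℚ.* b (m ∸ p)) ℚ.* c (n ∸ m))
    ≡⟨ sumLt-cong (suc n) (λ m → sym (sumLt-*ʳ (suc m) (c (n ∸ m)) _)) ⟩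
  sumLe n (λ m → sumLe m (λ p → a p ℚ.* b (m ∸ p) ℚ.* c (n ∸ m)))
    ≡⟨ sumLe-triangle n (λ p m → a p ℚ.* b (m ∸ p) ℚ.* c (n ∸ m)) ⟩
  sumLe n (λ p → sumLe (n ∸ p) (λ r → a p ℚ.* b ((p ℕ.+ r) ∸ p) ℚ.* c (n ∸ (p ℕ.+ r))))
    ≡⟨ sumLt-cong (suc n) (λ p → sumLt-cong (suc (n ∸ p)) (λ r →
         trans (cong₂ (λ u v → a p ℚ.* b u ℚ.* c v) (ℕP.m+n∸m≡n p r) (sym (ℕP.∸-+-assoc n p r)))
               (ℚP.*-assoc (a p) (b r) (c (n ∸ p ∸ r))))) ⟩
  sumLe n (λ p → sumLe (n ∸ p) (λ r → a p ℚ.* (b r ℚ.* c (n ∸ p ∸ r))))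
    ≡⟨ sumLt-cong (suc n) (λ p → sumLt-*ˡ (suc (n ∸ p)) (a p) _) ⟩
  sumLe n (λ p → a p ℚ.* sumLe (n ∸ p) (λ r → b r ℚ.* c (n ∸ p ∸ r))) ∎) ⟫
  where open ≡-Reasoning

SeriesRing : CommutativeRing _ _
SeriesRing = record
  { Carrier = Series ; _≈_ = _≋_ ; _+_ = _⊕_ ; _*_ = _⊛_ ; -_ = neg ; 0# = 0ₛ ; 1# = one
  ; isCommutativeRing = record
    { isRing = record
      { +-isAbelianGroup = record
        { isGroup = record
          { isMonoid = record
            { isSemigroup = record
              { isMagma = record { isEquivalence = Setoid.isEquivalence ≋-setoid ; ∙-cong = ⊕-cong }
              ; assoc = λ a b c → ⟪ (λ n → ℚP.+-assoc (a n) (b n) (c n)) ⟫ }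
            ; identity = (λ a → ⟪ (λ n → trans (cong (ℚ._+ a n) (0ₛ-coeff n)) (ℚP.+-identityˡ (a n))) ⟫)
                       , (λ a → ⟪ (λ n → trans (cong (a n ℚ.+_) (0ₛ-coeff n)) (ℚP.+-identityʳ (a n))) ⟫) }
          ; inverse = (λ a → ⟪ (λ n → trans (ℚP.+-inverseˡ (a n)) (sym (0ₛ-coeff n))) ⟫)
                    , (λ a → ⟪ (λ n → trans (ℚP.+-inverseʳ (a n)) (sym (0ₛ-coeff n))) ⟫)
          ; ⁻¹-cong = neg-cong }
        ; comm = λ a b → ⟪ (λ n → ℚP.+-comm (a n) (b n)) ⟫ }
      ; *-cong = ⊛-cong
      ; *-assoc = ⊛-assoc
      ; *-identity = one-⊛ , ⊛-one
      ; distrib = ⊛-distribˡ-⊕ , ⊛-distribʳ-⊕ }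
    ; *-comm = ⊛-comm } }

const-homomorphism : ACR._-Raw-AlmostCommutative⟶_ ℚP.+-*-rawRing (ACR.fromCommutativeRing SeriesRing)
const-homomorphism = record
  { ⟦_⟧    = const
  ; +-homo = λ p q → ⟪ (λ { zero → refl ; (suc n) → refl }) ⟫
  ; *-homo = λ p q → ⟪ (λ n → sym (trans (const-⊛-coeff p (const q) n) (const-* {p} {q} n))) ⟫
  ; -‿homo = λ p → ⟪ (λ { zero → refl ; (suc n) → refl }) ⟫
  ; 0-homo = ⟪ (λ { zero → refl ; (suc n) → refl }) ⟫
  ; 1-homo = ⟪ (λ { zero → refl ; (suc n) → refl }) ⟫ }
  where
  const-* : ∀ {p q} n → p ℚ.* const q n ≡ const (p ℚ.* q) n
  const-* {p} zero    = refl
  const-* {p} (suc n) = ℚP.*-zeroʳ p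

const-≟ : ∀ p q → Maybe (const p ≋ const q)
const-≟ p q with p ℚP.≟ q
... | yes refl = just ≋-refl
... | no _     = nothing

module SeriesSolver =
  Algebra.Solver.Ring ℚP.+-*-rawRing (ACR.fromCommutativeRing SeriesRing) const-homomorphism const-≟

⊛-zeroʳ : ∀ a → a ⊛ 0ₛ ≋ 0ₛ
⊛-zeroʳ a = ⟪ (λ n → trans (sumLt-cong (suc n) (λ m → trans (cong (a m ℚ.*_) (0ₛ-coeff (n ∸ m))) (ℚP.*-zeroʳ (a m))))
  (trans (sumLt-zero (suc n)) (sym (0ₛ-coeff n)))) ⟫

⊛-absorbˡ : ∀ {e} a → e ≋ 0ₛ → e ⊛ a ≋ 0ₛ
⊛-absorbˡ {e} a e≋0 = ≋-trans (⊛-congˡ a e≋0) (≋-trans (⊛-comm 0ₛ a) (⊛-zeroʳ a))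

⊕-≋0 : ∀ {a b} → a ≋ 0ₛ → b ≋ 0ₛ → a ⊕ b ≋ 0ₛ
⊕-≋0 {a} {b} a≋0 b≋0 =
  ≋-trans (⊕-cong a≋0 b≋0) ⟪ (λ n → trans (cong₂ ℚ._+_ (0ₛ-coeff n) (0ₛ-coeff n)) (sym (0ₛ-coeff n))) ⟫

≋⇒⊖≋0 : ∀ {a b} → a ≋ b → a ⊖ b ≋ 0ₛ
≋⇒⊖≋0 {a} {b} a≋b = ⟪ (λ n → trans (cong (ℚ._- b n) (ap a≋b n)) (trans (ℚP.+-inverseʳ (b n)) (sym (0ₛ-coeff n)))) ⟫

⊖≋0⇒≋ : ∀ {a b} → a ⊖ b ≋ 0ₛ → a ≋ b
⊖≋0⇒≋ {a} {b} a-b≋0 = ⟪ (λ n → begin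
  a n                      ≡⟨ ℚS.solve 2 (λ x y → x ℚS.:= (x ℚS.:- y) ℚS.:+ y) refl (a n) (b n) ⟩
  (a n ℚ.- b n) ℚ.+ b n    ≡⟨ cong (ℚ._+ b n) (trans (ap a-b≋0 n) (0ₛ-coeff n)) ⟩
  0ℚ ℚ.+ b n               ≡⟨ ℚP.+-identityˡ (b n) ⟩
  b n                      ∎) ⟫
  where open ≡-Reasoning

z⊛-coeff-zero : ∀ a → (zS ⊛ a) 0 ≡ 0ℚ
z⊛-coeff-zero a = trans (ℚP.+-identityˡ _) (ℚP.*-zeroˡ (a 0))

z⊛-coeff-suc : ∀ a n → (zS ⊛ a) (suc n) ≡ a n
z⊛-coeff-suc a n = begin
  sumLe (suc n) (λ m → zS m ℚ.* a (suc n ∸ m))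
    ≡⟨ sumLt-suc (suc n) _ ⟩
  0ℚ ℚ.* a (suc n) ℚ.+ sumLe n (λ m → zS (suc m) ℚ.* a (n ∸ m))
    ≡⟨ cong₂ ℚ._+_ (ℚP.*-zeroˡ (a (suc n))) (sumLt-suc n _) ⟩
  0ℚ ℚ.+ (1ℚ ℚ.* a n ℚ.+ sumLt n (λ m → 0ℚ ℚ.* a (n ∸ suc m)))
    ≡⟨ ℚP.+-identityˡ _ ⟩
  1ℚ ℚ.* a n ℚ.+ sumLt n (λ m → 0ℚ ℚ.* a (n ∸ suc m))
    ≡⟨ cong (1ℚ ℚ.* a n ℚ.+_) (trans (sumLt-cong n (λ m → ℚP.*-zeroˡ (a (n ∸ suc m)))) (sumLt-zero n)) ⟩
  1ℚ ℚ.* a n ℚ.+ 0ℚ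
    ≡⟨ trans (ℚP.+-identityʳ _) (ℚP.*-identityˡ (a n)) ⟩
  a n ∎
  where open ≡-Reasoning

z⊛-cancel : ∀ {a b} → zS ⊛ a ≋ zS ⊛ b → a ≋ b
z⊛-cancel {a} {b} za≋zb = ⟪ (λ n → trans (sym (z⊛-coeff-suc a n)) (trans (ap za≋zb (suc n)) (z⊛-coeff-suc b n))) ⟫

z⊛divZ : ∀ a → a 0 ≡ 0ℚ → zS ⊛ divZ a ≋ a
z⊛divZ a a₀≡0 = ⟪ (λ { zero → trans (z⊛-coeff-zero (divZ a)) (sym a₀≡0) ; (suc n) → z⊛-coeff-suc (divZ a) n }) ⟫

at-++ˡ : ∀ (xs ys : List ℚ) m → m ℕ.< length xs → at (xs ++ ys) m ≡ at xs m
at-++ˡ (x ∷ xs) ys zero    _         = refl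
at-++ˡ (x ∷ xs) ys (suc m) (s≤s m<n) = at-++ˡ xs ys m m<n

at-++-length : ∀ (xs : List ℚ) y → at (xs ++ y ∷ []) (length xs) ≡ y
at-++-length []       y = refl
at-++-length (x ∷ xs) y = at-++-length xs y

prefix-length : ∀ step n → length (prefix step n) ≡ n
prefix-length step zero    = refl
prefix-length step (suc n) = trans (ListP.length-++ (prefix step n))
  (trans (ℕP.+-comm (length (prefix step n)) 1) (cong suc (prefix-length step n)))

build-last : ∀ step n → build step n ≡ step (at (prefix step n)) n
build-last step n = subst (λ k → at (prefix step n ++ step (at (prefix step n)) n ∷ []) k ≡ step (at (prefix step n)) n)
  (prefix-length step n) (at-++-length (prefix step n) _)

prefix-at : ∀ step n m → m ℕ.< n → at (prefix step n) m ≡ build step m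
prefix-at step (suc n) m m<1+n with ℕP.m<1+n⇒m<n∨m≡n m<1+n
... | inj₁ m<n  = trans (at-++ˡ (prefix step n) _ m (subst (m ℕ.<_) (sym (prefix-length step n)) m<n))
                        (prefix-at step n m m<n)
... | inj₂ refl = refl

*-recip : ∀ p → p ≢ 0ℚ → p ℚ.* recip p ≡ 1ℚ
*-recip p p≢0 with p ℚ.≟ 0ℚ
... | yes p≡0 = ⊥-elim (p≢0 p≡0)
... | no  p≢0′ = ℚP.*-inverseʳ p {{ℚ.≢-nonZero p≢0′}}

inv-coeff-suc : ∀ a n → inv a (suc n) ≡ ℚ.- (recip (a 0) ℚ.* sumLe n (λ m → a (suc m) ℚ.* inv a (n ∸ m)))
inv-coeff-suc a n = trans (build-last _ (suc n)) (cong (λ t → ℚ.- (recip (a 0) ℚ.* t))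
  (sumLt-cong (suc n) (λ m → cong (a (suc m) ℚ.*_) (prefix-at _ (suc n) (n ∸ m) (s≤s (ℕP.m∸n≤m n m))))))

⊛-inv : ∀ a → a 0 ≢ 0ℚ → a ⊛ inv a ≋ one
⊛-inv a a₀≢0 = ⟪ (λ { zero → trans (ℚP.+-identityˡ _) (*-recip (a 0) a₀≢0) ; (suc n) → coeff-suc n }) ⟫
  where
  coeff-suc : ∀ n → (a ⊛ inv a) (suc n) ≡ 0ℚ
  coeff-suc n = begin
    sumLe (suc n) (λ m → a m ℚ.* inv a (suc n ∸ m))          ≡⟨ sumLt-suc (suc n) _ ⟩
    a 0 ℚ.* inv a (suc n) ℚ.+ S                              ≡⟨ cong (λ t → a 0 ℚ.* t ℚ.+ S) (inv-coeff-suc a n) ⟩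
    a 0 ℚ.* (ℚ.- (recip (a 0) ℚ.* S)) ℚ.+ S                  ≡⟨ regroup (a 0) (recip (a 0)) S ⟩
    ℚ.- ((a 0 ℚ.* recip (a 0)) ℚ.* S) ℚ.+ S                  ≡⟨ cong (λ t → ℚ.- (t ℚ.* S) ℚ.+ S) (*-recip (a 0) a₀≢0) ⟩
    ℚ.- (1ℚ ℚ.* S) ℚ.+ S                                     ≡⟨ cancel S ⟩
    0ℚ                                                       ∎
    where
    open ≡-Reasoning
    open ℚS
    S = sumLe n (λ m → a (suc m) ℚ.* inv a (n ∸ m))
    regroup : ∀ x y s → x ℚ.* (ℚ.- (y ℚ.* s)) ℚ.+ s ≡ ℚ.- ((x ℚ.* y) ℚ.* s) ℚ.+ s
    regroup = solve 3 (λ x y s → x :* (:- (y :* s)) :+ s := :- ((x :* y) :* s) :+ s) refl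
    cancel : ∀ s → ℚ.- (1ℚ ℚ.* s) ℚ.+ s ≡ 0ℚ
    cancel = solve 1 (λ s → :- (con 1ℚ :* s) :+ s := con 0ℚ) refl

sqrt1m-coeff-suc : ∀ u n → sqrt1m u (suc n) ≡
  (ℚ.- u (suc n) ℚ.- sumLt n (λ m → sqrt1m u (suc m) ℚ.* sqrt1m u (n ∸ m))) ℚ.* (+ 1 ℚ./ 2)
sqrt1m-coeff-suc u n = trans (build-last _ (suc n)) (cong (λ t → (ℚ.- u (suc n) ℚ.- t) ℚ.* (+ 1 ℚ./ 2))
  (sumLt-cong-< n (λ m m<n → cong₂ ℚ._*_ (prefix-at _ (suc n) (suc m) (s≤s m<n))
                                          (prefix-at _ (suc n) (n ∸ m) (s≤s (ℕP.m∸n≤m n m))))))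

sqrt1m-square : ∀ u → u 0 ≡ 0ℚ → sqrt1m u ⊛ sqrt1m u ≋ one ⊖ u
sqrt1m-square u u₀≡0 = ⟪ (λ { zero → trans (ℚP.+-identityˡ _) (cong (λ t → 1ℚ ℚ.- t) (sym u₀≡0)) ; (suc n) → coeff-suc n }) ⟫
  where
  s = sqrt1m u
  coeff-suc : ∀ n → (s ⊛ s) (suc n) ≡ 0ℚ ℚ.- u (suc n)
  coeff-suc n = begin
    sumLe (suc n) (λ m → s m ℚ.* s (suc n ∸ m))
      ≡⟨ sumLt-suc (suc n) _ ⟩
    1ℚ ℚ.* s (suc n) ℚ.+ (S ℚ.+ s (suc n) ℚ.* s (n ∸ n))
      ≡⟨ cong (λ k → 1ℚ ℚ.* s (suc n) ℚ.+ (S ℚ.+ s (suc n) ℚ.* s k)) (ℕP.n∸n≡0 n) ⟩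
    1ℚ ℚ.* s (suc n) ℚ.+ (S ℚ.+ s (suc n) ℚ.* 1ℚ)
      ≡⟨ cong (λ t → 1ℚ ℚ.* t ℚ.+ (S ℚ.+ t ℚ.* 1ℚ)) (sqrt1m-coeff-suc u n) ⟩
    1ℚ ℚ.* ((ℚ.- U ℚ.- S) ℚ.* ½) ℚ.+ (S ℚ.+ ((ℚ.- U ℚ.- S) ℚ.* ½) ℚ.* 1ℚ)
      ≡⟨ ℚS.solve 2 (λ x y → con 1ℚ :* ((:- x :- y) :* con ½) :+ (y :+ ((:- x :- y) :* con ½) :* con 1ℚ)
                                := (:- x :- y) :* (con ½ :+ con ½) :+ y) refl U S ⟩
    (ℚ.- U ℚ.- S) ℚ.* 1ℚ ℚ.+ S
      ≡⟨ ℚS.solve 2 (λ x y → (:- x :- y) :* con 1ℚ :+ y := con 0ℚ :- x) refl U S ⟩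
    0ℚ ℚ.- U ∎
    where
    open ≡-Reasoning
    open ℚS using (con; _:=_; _:+_; _:*_; _:-_; :-_)
    U = u (suc n)
    S = sumLt n (λ m → s (suc m) ℚ.* s (n ∸ m))

open SeriesSolver using (solve; _:=_; _:+_; _:*_; _:-_; :-_; _:^_; con)

infix 4 _∈O[z^_] _≈[_]_

record _∈O[z^_] (a : Series) (p : ℕ) : Set where
  constructor vanishing
  field vanish : ∀ m → m ℕ.< p → a m ≡ 0ℚ
open _∈O[z^_] public

record _≈[_]_ (a : Series) (n : ℕ) (b : Series) : Set where
  constructor agreeing
  field agree : ∀ m → m ℕ.≤ n → a m ≡ b m
open _≈[_]_ public

≋⇒≈[] : ∀ {n a b} → a ≋ b → a ≈[ n ] b
≋⇒≈[] a≋b = agreeing (λ m _ → ap a≋b m)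

≈[]⇒≋ : ∀ {a b} → (∀ n → a ≈[ n ] b) → a ≋ b
≈[]⇒≋ a≈b = ⟪ (λ m → agree (a≈b m) m ℕP.≤-refl) ⟫

≈[]-refl : ∀ {n a} → a ≈[ n ] a
≈[]-refl = agreeing (λ m _ → refl)

≈[]-trans : ∀ {n a b c} → a ≈[ n ] b → b ≈[ n ] c → a ≈[ n ] c
≈[]-trans a≈b b≈c = agreeing (λ m m≤n → trans (agree a≈b m m≤n) (agree b≈c m m≤n))

⊕-cong-≈[] : ∀ {n a a′ b b′} → a ≈[ n ] a′ → b ≈[ n ] b′ → a ⊕ b ≈[ n ] a′ ⊕ b′
⊕-cong-≈[] p q = agreeing (λ m m≤n → cong₂ ℚ._+_ (agree p m m≤n) (agree q m m≤n))

⊖-cong-≈[] : ∀ {n a a′ b b′} → a ≈[ n ] a′ → b ≈[ n ] b′ → a ⊖ b ≈[ n ] a′ ⊖ b′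
⊖-cong-≈[] p q = agreeing (λ m m≤n → cong₂ ℚ._-_ (agree p m m≤n) (agree q m m≤n))

⊛-cong-≈[] : ∀ {n a a′ b b′} → a ≈[ n ] a′ → b ≈[ n ] b′ → a ⊛ b ≈[ n ] a′ ⊛ b′
⊛-cong-≈[] p q = agreeing (λ m m≤n → sumLt-cong-< (suc m) (λ i i≤m →
  cong₂ ℚ._*_ (agree p i (ℕP.≤-trans (ℕP.≤-pred i≤m) m≤n)) (agree q (m ∸ i) (ℕP.≤-trans (ℕP.m∸n≤m m i) m≤n))))

⊛-congʳ-≈[] : ∀ {n} a {b b′} → b ≈[ n ] b′ → a ⊛ b ≈[ n ] a ⊛ b′
⊛-congʳ-≈[] a = ⊛-cong-≈[] (≈[]-refl {a = a})

O-≋ : ∀ {a b p} → a ≋ b → a ∈O[z^ p ] → b ∈O[z^ p ]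
O-≋ a≋b a∈O = vanishing (λ m m<p → trans (sym (ap a≋b m)) (vanish a∈O m m<p))

O-weaken : ∀ {a p p′} → p′ ℕ.≤ p → a ∈O[z^ p ] → a ∈O[z^ p′ ]
O-weaken p′≤p a∈O = vanishing (λ m m<p′ → vanish a∈O m (ℕP.≤-trans m<p′ p′≤p))

O⇒≈[]0 : ∀ {a n} → a ∈O[z^ suc n ] → a ≈[ n ] 0ₛ
O⇒≈[]0 a∈O = agreeing (λ m m≤n → trans (vanish a∈O m (s≤s m≤n)) (sym (0ₛ-coeff m)))

O-const-coeff : ∀ {a p} → a ∈O[z^ suc p ] → a 0 ≡ 0ℚ
O-const-coeff a∈O = vanish a∈O 0 (s≤s z≤n)

O-zero : ∀ {a} → a ∈O[z^ 0 ]
O-zero = vanishing (λ m ())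

O-⊕ : ∀ {a b p} → a ∈O[z^ p ] → b ∈O[z^ p ] → a ⊕ b ∈O[z^ p ]
O-⊕ a∈O b∈O = vanishing (λ m m<p → cong₂ ℚ._+_ (vanish a∈O m m<p) (vanish b∈O m m<p))

O-⊖ : ∀ {a b p} → a ∈O[z^ p ] → b ∈O[z^ p ] → a ⊖ b ∈O[z^ p ]
O-⊖ a∈O b∈O = vanishing (λ m m<p → cong₂ ℚ._-_ (vanish a∈O m m<p) (vanish b∈O m m<p))

O-neg : ∀ {a p} → a ∈O[z^ p ] → neg a ∈O[z^ p ]
O-neg a∈O = vanishing (λ m m<p → cong ℚ.-_ (vanish a∈O m m<p))

O-⊛ : ∀ {a b p r} → a ∈O[z^ p ] → b ∈O[z^ r ] → a ⊛ b ∈O[z^ p ℕ.+ r ]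
O-⊛ {a} {b} {p} {r} a∈O b∈O = vanishing (λ m m<p+r → trans (sumLt-cong-< (suc m) (term m m<p+r)) (sumLt-zero (suc m)))
  where
  term : ∀ m → m ℕ.< p ℕ.+ r → ∀ i → i ℕ.< suc m → a i ℚ.* b (m ∸ i) ≡ 0ℚ
  term m m<p+r i i≤m with i ℕP.<? p
  ... | yes i<p = trans (cong (ℚ._* b (m ∸ i)) (vanish a∈O i i<p)) (ℚP.*-zeroˡ (b (m ∸ i)))
  ... | no  i≮p = trans (cong (a i ℚ.*_) (vanish b∈O (m ∸ i) m-i<r)) (ℚP.*-zeroʳ (a i))
    where
    m-i<r : m ∸ i ℕ.< r
    m-i<r = ℕP.+-cancelˡ-< p (m ∸ i) r (ℕP.≤-<-trans (ℕP.+-monoˡ-≤ (m ∸ i) (ℕP.≮⇒≥ i≮p))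
              (subst (ℕ._< p ℕ.+ r) (sym (ℕP.m+[n∸m]≡n (ℕP.≤-pred i≤m))) m<p+r))

O-⊛ˡ : ∀ {a b p} → a ∈O[z^ p ] → a ⊛ b ∈O[z^ p ]
O-⊛ˡ {a} {b} {p} a∈O = subst (a ⊛ b ∈O[z^_]) (ℕP.+-identityʳ p) (O-⊛ {a} {b} {p} {0} a∈O O-zero)

O-⊛ʳ : ∀ {a b p} → b ∈O[z^ p ] → a ⊛ b ∈O[z^ p ]
O-⊛ʳ {a} {b} {p} b∈O = O-⊛ {a} {b} {0} {p} O-zero b∈O

O-z : zS ∈O[z^ 1 ]
O-z = vanishing (λ { zero _ → refl ; (suc m) (s≤s ()) })

O-z⊛ : ∀ a → zS ⊛ a ∈O[z^ 1 ]
O-z⊛ a = O-⊛ˡ {zS} {a} O-z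

O-pow : ∀ {a} k → a ∈O[z^ 1 ] → pow a k ∈O[z^ k ]
O-pow         zero    a∈O = O-zero
O-pow {a} (suc k) a∈O = O-⊛ {a} {pow a k} {1} {k} a∈O (O-pow k a∈O)

one⊖O≈[]one : ∀ {n x} → x ∈O[z^ suc n ] → one ⊖ x ≈[ n ] one
one⊖O≈[]one {n} {x} x∈O = ≈[]-trans (⊖-cong-≈[] (≈[]-refl {a = one}) (O⇒≈[]0 x∈O))
  (≋⇒≈[] ⟪ (λ m → trans (cong (λ t → one m ℚ.- t) (0ₛ-coeff m)) (ℚP.+-identityʳ (one m))) ⟫)

finSum : ℕ → (ℕ → Series) → Series
finSum N h m = sumLe N (λ k → h k m)

finSum-cong : ∀ N {h h′ : ℕ → Series} → (∀ k → h k ≋ h′ k) → finSum N h ≋ finSum N h′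
finSum-cong N h≋h′ = ⟪ (λ m → sumLt-cong (suc N) (λ k → ap (h≋h′ k) m)) ⟫

finSum-cong-≈[] : ∀ N {n} {h h′ : ℕ → Series} → (∀ k → h k ≈[ n ] h′ k) → finSum N h ≈[ n ] finSum N h′
finSum-cong-≈[] N h≈h′ = agreeing (λ m m≤n → sumLt-cong (suc N) (λ k → agree (h≈h′ k) m m≤n))

finSum-⊕ : ∀ N (h h′ : ℕ → Series) → finSum N (λ k → h k ⊕ h′ k) ≋ finSum N h ⊕ finSum N h′
finSum-⊕ N h h′ = ⟪ (λ m → sumLt-+ (suc N) (λ k → h k m) (λ k → h′ k m)) ⟫

finSum-⊖ : ∀ N (h h′ : ℕ → Series) → finSum N (λ k → h k ⊖ h′ k) ≋ finSum N h ⊖ finSum N h′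
finSum-⊖ N h h′ = ⟪ (λ m → sumLt-- (suc N) (λ k → h k m) (λ k → h′ k m)) ⟫

⊛-finSum : ∀ N a (h : ℕ → Series) → a ⊛ finSum N h ≋ finSum N (λ k → a ⊛ h k)
⊛-finSum N a h = ⟪ (λ m → trans (sumLt-cong (suc m) (λ i → sym (sumLt-*ˡ (suc N) (a i) (λ k → h k (m ∸ i)))))
                                (sumLt-swap (suc m) (suc N) (λ i k → a i ℚ.* h k (m ∸ i)))) ⟫

finSum-⊛ : ∀ N (h : ℕ → Series) a → finSum N h ⊛ a ≋ finSum N (λ k → h k ⊛ a)
finSum-⊛ N h a = ≋-trans (⊛-comm (finSum N h) a) (≋-trans (⊛-finSum N a h) (finSum-cong N (λ k → ⊛-comm a (h k))))

finSum-swap : ∀ n N (s : ℕ → ℕ → Series) →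
  finSum n (λ i → finSum N (λ k → s k i)) ≋ finSum N (λ k → finSum n (s k))
finSum-swap n N s = ⟪ (λ m → sumLt-swap (suc n) (suc N) (λ i k → s k i m)) ⟫

finSum-telescope : ∀ N (H : ℕ → Series) → finSum N (λ k → H k ⊖ H (suc k)) ≋ H 0 ⊖ H (suc N)
finSum-telescope N H = ⟪ go N ⟫
  where
  collapse : ∀ x y w → (x ℚ.- y) ℚ.+ (y ℚ.- w) ≡ x ℚ.- w
  collapse = ℚS.solve 3 (λ x y w → (x ℚS.:- y) ℚS.:+ (y ℚS.:- w) ℚS.:= x ℚS.:- w) refl
  go : ∀ N → finSum N (λ k → H k ⊖ H (suc k)) ≈ H 0 ⊖ H (suc N)
  go zero    m = ℚP.+-identityˡ _
  go (suc N) m = trans (cong (ℚ._+ (H (suc N) m ℚ.- H (suc (suc N)) m)) (go N m))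
                       (collapse (H 0 m) (H (suc N) m) (H (suc (suc N)) m))

finSum-zero : ∀ N → finSum N (λ _ → 0ₛ) ≋ 0ₛ
finSum-zero N = ⟪ (λ m → trans (sumLt-cong (suc N) (λ _ → 0ₛ-coeff m)) (trans (sumLt-zero (suc N)) (sym (0ₛ-coeff m)))) ⟫

finSum-head : ∀ N (h : ℕ → Series) → (∀ k → h (suc k) ≋ 0ₛ) → finSum N h ≋ h 0
finSum-head N h tail≋0 = ⟪ (λ m → trans (sumLt-suc N (λ k → h k m))
  (trans (cong (h 0 m ℚ.+_) (trans (sumLt-cong N (λ k → trans (ap (tail≋0 k) m) (0ₛ-coeff m))) (sumLt-zero N)))
         (ℚP.+-identityʳ (h 0 m)))) ⟫

sumSeries-≈[]-finSum : ∀ (σ : ℕ → Series) → (∀ k → σ k ∈O[z^ suc k ]) → ∀ N → sumSeries σ ≈[ N ] finSum N σ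
sumSeries-≈[]-finSum σ σ∈O N = agreeing (λ m m≤N →
  sumLe-pad m N (λ k → σ k m) (λ k m<k → vanish (σ∈O k) m (s≤s (ℕP.<⇒≤ m<k))) m≤N)

sumSeries-⊕ : ∀ (σ τ : ℕ → Series) → sumSeries (λ k → σ k ⊕ τ k) ≋ sumSeries σ ⊕ sumSeries τ
sumSeries-⊕ σ τ = ⟪ (λ n → sumLt-+ (suc n) (λ k → σ k n) (λ k → τ k n)) ⟫

sumSeries-cong : ∀ {σ τ : ℕ → Series} → (∀ k → σ k ≋ τ k) → sumSeries σ ≋ sumSeries τ
sumSeries-cong σ≋τ = ⟪ (λ n → sumLt-cong (suc n) (λ k → ap (σ≋τ k) n)) ⟫

-- The kernel, f, and the series α_k, β_k

2ℚ 4ℚ 8ℚ ¼ ⅛ : ℚ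
2ℚ = + 2 ℚ./ 1
4ℚ = + 4 ℚ./ 1
8ℚ = + 8 ℚ./ 1
¼  = + 1 ℚ./ 4
⅛  = + 1 ℚ./ 8

1≢0 : 1ℚ ≢ 0ℚ
1≢0 ()

kernel : Series → Series → Series
kernel a b = a ⊛ b ⊖ zS ⊛ (a ⊛ a ⊕ b ⊛ b ⊕ a ⊛ a ⊛ (b ⊛ b))

kernel-sym : ∀ a b → kernel a b ≋ kernel b a
kernel-sym a b = solve 3 (λ a b z → a :* b :- z :* (a :* a :+ b :* b :+ a :* a :* (b :* b))
                                 := b :* a :- z :* (b :* b :+ a :* a :+ b :* b :* (a :* a))) ≋-refl a b zS

-- Each certificate below writes the series to be shown zero as an explicit
-- combination of the defining equations of the square root, the quotient by z
-- and the inverse occurring in it.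
module Kernel-f (t : Series) (t₀≡0 : t 0 ≡ 0ℚ) where
  P = one ⊕ pow t 2
  u = const 4ℚ ⊛ zS ⊛ zS ⊛ P
  s = sqrt1m u
  D = divZ (one ⊖ s)
  I = inv (const 2ℚ ⊛ P)
  g = D ⊛ I

  u₀≡0 : u 0 ≡ 0ℚ
  u₀≡0 = O-const-coeff (O-⊛ˡ {const 4ℚ ⊛ zS ⊛ zS} {P} (O-⊛ˡ {const 4ℚ ⊛ zS} {zS} (O-⊛ʳ {const 4ℚ} O-z)))

  P₀≡1 : P 0 ≡ 1ℚ
  P₀≡1 = cong (1ℚ ℚ.+_) (trans (ℚP.+-identityˡ _) (trans (cong (ℚ._* (t ⊛ one) 0) t₀≡0) (ℚP.*-zeroˡ ((t ⊛ one) 0))))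

  divZ-eq : zS ⊛ D ⊖ (one ⊖ s) ≋ 0ₛ
  divZ-eq = ≋⇒⊖≋0 (z⊛divZ (one ⊖ s) refl)

  inv-eq : I ⊛ (const 2ℚ ⊛ P) ⊖ one ≋ 0ₛ
  inv-eq = ≋⇒⊖≋0 (≋-trans (⊛-comm I (const 2ℚ ⊛ P)) (⊛-inv (const 2ℚ ⊛ P) 2P₀≢0))
    where
    2P₀≢0 : (const 2ℚ ⊛ P) 0 ≢ 0ℚ
    2P₀≢0 eq with trans (sym (cong (2ℚ ℚ.*_) P₀≡1)) (trans (sym (const-⊛-coeff 2ℚ P 0)) eq)
    ... | ()

  sqrt-eq : s ⊛ s ⊖ (one ⊖ u) ≋ 0ₛ
  sqrt-eq = ≋⇒⊖≋0 (sqrt1m-square u u₀≡0)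

  g-fixpoint-defect : Series
  g-fixpoint-defect = g ⊖ zS ⊛ (one ⊕ g ⊛ g ⊛ P)

  g-fixpoint-defect≋0 : g-fixpoint-defect ≋ 0ₛ
  g-fixpoint-defect≋0 = z⊛-cancel (≋-trans certificate (≋-trans
    (⊕-≋0 (⊕-≋0 (⊛-absorbˡ A₁ divZ-eq) (⊛-absorbˡ A₂ inv-eq)) (⊛-absorbˡ A₃ sqrt-eq)) (≋-sym (⊛-zeroʳ zS))))
    where
    A₁ = const ½ ⊛ I ⊛ (const 2ℚ ⊖ const 2ℚ ⊛ zS ⊛ D ⊕ (zS ⊛ D ⊖ (one ⊖ s)))
    A₂ = neg (const ½ ⊛ I ⊛ zS ⊛ (const 2ℚ ⊛ zS ⊛ D ⊛ D ⊕ zS ⊛ (I ⊛ (const 2ℚ ⊛ P) ⊖ one) ⊛ D ⊛ D ⊖ const 2ℚ ⊛ D))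
         ⊕ zS ⊛ (zS ⊛ P ⊛ g ⊛ g ⊖ g ⊕ zS)
    A₃ = neg (const ½ ⊛ I)
    certificate : zS ⊛ g-fixpoint-defect ≋
      (zS ⊛ D ⊖ (one ⊖ s)) ⊛ A₁ ⊕ (I ⊛ (const 2ℚ ⊛ P) ⊖ one) ⊛ A₂ ⊕ (s ⊛ s ⊖ (one ⊖ u)) ⊛ A₃
    certificate = solve 5 (λ z P D I s →
      z :* (D :* I :- z :* (con 1ℚ :+ D :* I :* (D :* I) :* P))
      := (z :* D :- (con 1ℚ :- s)) :* (con ½ :* I :* (con 2ℚ :- con 2ℚ :* z :* D :+ (z :* D :- (con 1ℚ :- s))))
         :+ (I :* (con 2ℚ :* P) :- con 1ℚ)
            :* ((:- (con ½ :* I :* z :* (con 2ℚ :* z :* D :* D :+ z :* (I :* (con 2ℚ :* P) :- con 1ℚ) :* D :* D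
                                          :- con 2ℚ :* D)))
                :+ z :* (z :* P :* (D :* I) :* (D :* I) :- D :* I :+ z))
         :+ (s :* s :- (con 1ℚ :- con 4ℚ :* z :* z :* P)) :* (:- (con ½ :* I))) ≋-refl zS P D I s

  f-kernel : kernel t (f t) ≋ 0ₛ
  f-kernel = ≋-trans
    (solve 3 (λ t g z → t :* (g :* t) :- z :* (t :* t :+ g :* t :* (g :* t) :+ t :* t :* (g :* t :* (g :* t)))
                     := (t :* t) :* (g :- z :* (con 1ℚ :+ g :* g :* (con 1ℚ :+ t :^ 2)))) ≋-refl t g zS)
    (≋-trans (⊛-congʳ (t ⊛ t) g-fixpoint-defect≋0) (⊛-zeroʳ (t ⊛ t)))

  f-order : ∀ p → t ∈O[z^ p ] → f t ∈O[z^ suc p ]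
  f-order p t∈O = O-⊛ {g} {t} {1} {p} g∈O t∈O
    where
    g∈O : g ∈O[z^ 1 ]
    g∈O = O-≋ (≋-sym (⊖≋0⇒≋ {g} {zS ⊛ (one ⊕ g ⊛ g ⊛ P)} g-fixpoint-defect≋0)) (O-z⊛ (one ⊕ g ⊛ g ⊛ P))

module Kernel-α₀β₀ where
  u = const 8ℚ ⊛ zS ⊛ zS
  s = sqrt1m u
  D = divZ (one ⊖ s)

  divZ-eq : zS ⊛ D ⊖ (one ⊖ s) ≋ 0ₛ
  divZ-eq = ≋⇒⊖≋0 (z⊛divZ (one ⊖ s) refl)

  sqrt-eq : s ⊛ s ⊖ (one ⊖ u) ≋ 0ₛ
  sqrt-eq = ≋⇒⊖≋0 (sqrt1m-square u (O-const-coeff (O-⊛ˡ {const 8ℚ ⊛ zS} {zS} (O-⊛ʳ {const 8ℚ} O-z))))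

  α₀-quadratic : const 2ℚ ⊛ zS ⊛ α₀ ⊛ α₀ ⊖ α₀ ⊕ zS ≋ 0ₛ
  α₀-quadratic = z⊛-cancel (≋-trans certificate (≋-trans
    (⊕-≋0 (⊛-absorbˡ B divZ-eq) (⊛-absorbˡ (const ⅛) sqrt-eq)) (≋-sym (⊛-zeroʳ zS))))
    where
    B = neg (const ⅛ ⊛ (const 2ℚ ⊖ const 2ℚ ⊛ zS ⊛ D ⊕ (zS ⊛ D ⊖ (one ⊖ s))))
    certificate : zS ⊛ (const 2ℚ ⊛ zS ⊛ α₀ ⊛ α₀ ⊖ α₀ ⊕ zS) ≋
      (zS ⊛ D ⊖ (one ⊖ s)) ⊛ B ⊕ (s ⊛ s ⊖ (one ⊖ u)) ⊛ const ⅛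
    certificate = solve 3 (λ z D s →
      z :* (con 2ℚ :* z :* (D :* con ¼) :* (D :* con ¼) :- D :* con ¼ :+ z)
      := (z :* D :- (con 1ℚ :- s)) :* (:- (con ⅛ :* (con 2ℚ :- con 2ℚ :* z :* D :+ (z :* D :- (con 1ℚ :- s)))))
         :+ (s :* s :- (con 1ℚ :- con 8ℚ :* z :* z)) :* con ⅛) ≋-refl zS D s

  α₀-order : α₀ ∈O[z^ 1 ]
  α₀-order = O-≋ (≋-sym α₀-fixpoint) (O-z⊛ (one ⊕ const 2ℚ ⊛ α₀ ⊛ α₀))
    where
    α₀-fixpoint : α₀ ≋ zS ⊛ (one ⊕ const 2ℚ ⊛ α₀ ⊛ α₀)
    α₀-fixpoint = ⊖≋0⇒≋ {α₀} {zS ⊛ (one ⊕ const 2ℚ ⊛ α₀ ⊛ α₀)} (≋-trans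
      (solve 2 (λ a z → a :- z :* (con 1ℚ :+ con 2ℚ :* a :* a) := :- (con 2ℚ :* z :* a :* a :- a :+ z)) ≋-refl α₀ zS)
      (≋-trans (neg-cong α₀-quadratic) ⟪ (λ { zero → refl ; (suc n) → refl }) ⟫))

  J = inv (one ⊕ pow α₀ 2)

  inv-eq : J ⊛ (one ⊕ pow α₀ 2) ⊖ one ≋ 0ₛ
  inv-eq = ≋⇒⊖≋0 (≋-trans (⊛-comm J (one ⊕ pow α₀ 2))
                          (⊛-inv (one ⊕ pow α₀ 2) (λ eq → 1≢0 (trans (sym (Kernel-f.P₀≡1 α₀ α₀₀≡0)) eq))))
    where
    α₀₀≡0 = O-const-coeff α₀-order

  kernel-α₀-β₀ : kernel α₀ β₀ ≋ 0ₛ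
  kernel-α₀-β₀ = ≋-trans certificate (⊕-≋0 (⊛-absorbˡ C₁ α₀-quadratic) (⊛-absorbˡ C₂ inv-eq))
    where
    a = α₀
    X = a ⊖ zS ⊛ pow a 2 ⊛ (const 2ℚ ⊕ (J ⊛ (one ⊕ pow a 2) ⊖ one))
    E = a ⊛ J ⊖ zS ⊛ (one ⊕ a ⊛ J ⊛ (a ⊛ J) ⊛ (one ⊕ pow a 2))
    C₁ = neg (pow a 2 ⊛ J)
    C₂ = pow a 2 ⊛ J ⊛ X ⊖ pow a 2 ⊛ E
    certificate : kernel a β₀ ≋ (const 2ℚ ⊛ zS ⊛ a ⊛ a ⊖ a ⊕ zS) ⊛ C₁ ⊕ (J ⊛ (one ⊕ pow a 2) ⊖ one) ⊛ C₂
    certificate = solve 3 (λ a J z →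
      a :* (a :^ 2 :* J) :- z :* (a :* a :+ (a :^ 2 :* J) :* (a :^ 2 :* J) :+ a :* a :* ((a :^ 2 :* J) :* (a :^ 2 :* J)))
      := (con 2ℚ :* z :* a :* a :- a :+ z) :* (:- (a :^ 2 :* J))
         :+ (J :* (con 1ℚ :+ a :^ 2) :- con 1ℚ) :*
            (a :^ 2 :* J :* (a :- z :* a :^ 2 :* (con 2ℚ :+ (J :* (con 1ℚ :+ a :^ 2) :- con 1ℚ)))
             :- a :^ 2 :* (a :* J :- z :* (con 1ℚ :+ a :* J :* (a :* J) :* (con 1ℚ :+ a :^ 2))))) ≋-refl a J zS

  β₀-order : β₀ ∈O[z^ 2 ]
  β₀-order = O-⊛ˡ {pow α₀ 2} {J} (O-pow 2 α₀-order)

α-β-order : ∀ k → α k ∈O[z^ suc k ] × β k ∈O[z^ suc (suc k) ]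
α-β-order zero    = Kernel-α₀β₀.α₀-order , Kernel-α₀β₀.β₀-order
α-β-order (suc k) = O-weaken (ℕP.n≤1+n _) α′∈O ,
                    O-weaken (ℕP.n≤1+n _) (Kernel-f.f-order (α (suc k)) (O-const-coeff α′∈O) _ α′∈O)
  where
  β∈O = proj₂ (α-β-order k)
  α′∈O = Kernel-f.f-order (β k) (O-const-coeff β∈O) _ β∈O

α-order : ∀ k → α k ∈O[z^ suc k ]
α-order k = proj₁ (α-β-order k)

β-order : ∀ k → β k ∈O[z^ suc (suc k) ]
β-order k = proj₂ (α-β-order k)

α-order₁ : ∀ k → α k ∈O[z^ 1 ]
α-order₁ k = O-weaken (s≤s z≤n) (α-order k)

β-order₁ : ∀ k → β k ∈O[z^ 1 ]
β-order₁ k = O-weaken (s≤s z≤n) (β-order k)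

kernel-α-β : ∀ k → kernel (α k) (β k) ≋ 0ₛ
kernel-α-β zero    = Kernel-α₀β₀.kernel-α₀-β₀
kernel-α-β (suc k) = Kernel-f.f-kernel (α (suc k)) (O-const-coeff (α-order (suc k)))

kernel-α′-β : ∀ k → kernel (α (suc k)) (β k) ≋ 0ₛ
kernel-α′-β k = ≋-trans (kernel-sym (f (β k)) (β k)) (Kernel-f.f-kernel (β k) (O-const-coeff (β-order k)))

-- Recursion defects of families of series

Family : Set
Family = ℕ → ℕ → Series

-- The points from which one step reaches (i, j), listed as in the recursion for q.
preds : ℕ → ℕ → List (ℕ × ℕ)
preds (suc i) (suc j) = (i , suc (suc j)) ∷ (suc (suc i) , j) ∷ (suc (suc i) , suc (suc j)) ∷ []
preds (suc i) zero    = (i , 1) ∷ (suc (suc i) , 1) ∷ (i , 0) ∷ (suc (suc i) , 0) ∷ []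
preds zero    (suc j) = (1 , j) ∷ (1 , suc (suc j)) ∷ (0 , j) ∷ (0 , suc (suc j)) ∷ []
preds zero    zero    = (0 , 1) ∷ (1 , 1) ∷ (1 , 0) ∷ []

sumOver : Family → List (ℕ × ℕ) → Series
sumOver F []            = 0ₛ
sumOver F ((p , q) ∷ l) = F p q ⊕ sumOver F l

predSum : Family → ℕ → ℕ → Series
predSum F i j = sumOver F (preds i j)

defect : Family → ℕ → ℕ → Series
defect F i j = F i j ⊖ zS ⊛ predSum F i j

originDefect : Family → Series
originDefect F = defect F 0 0 ⊖ zS ⊛ F 0 0

sumOver-cong : ∀ {F G : Family} l → (∀ p q → F p q ≋ G p q) → sumOver F l ≋ sumOver G l
sumOver-cong []            F≋G = ≋-refl
sumOver-cong ((p , q) ∷ l) F≋G = ⊕-cong (F≋G p q) (sumOver-cong l F≋G)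

sumOver-coeff : ∀ {F G : Family} n l → (∀ p q → F p q n ≡ G p q n) → sumOver F l n ≡ sumOver G l n
sumOver-coeff n []            F≡G = refl
sumOver-coeff n ((p , q) ∷ l) F≡G = cong₂ ℚ._+_ (F≡G p q) (sumOver-coeff n l F≡G)

sumOver-⊕ : ∀ (F G : Family) l → sumOver (λ p q → F p q ⊕ G p q) l ≋ sumOver F l ⊕ sumOver G l
sumOver-⊕ F G []            = ⟪ (λ { zero → refl ; (suc n) → refl }) ⟫
sumOver-⊕ F G ((p , q) ∷ l) = ≋-trans (⊕-congʳ (F p q ⊕ G p q) (sumOver-⊕ F G l))
  (solve 4 (λ a b c d → (a :+ b) :+ (c :+ d) := (a :+ c) :+ (b :+ d)) ≋-refl (F p q) (G p q) (sumOver F l) (sumOver G l))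

sumOver-⊖ : ∀ (F G : Family) l → sumOver (λ p q → F p q ⊖ G p q) l ≋ sumOver F l ⊖ sumOver G l
sumOver-⊖ F G []            = ⟪ (λ { zero → refl ; (suc n) → refl }) ⟫
sumOver-⊖ F G ((p , q) ∷ l) = ≋-trans (⊕-congʳ (F p q ⊖ G p q) (sumOver-⊖ F G l))
  (solve 4 (λ a b c d → (a :- b) :+ (c :- d) := (a :+ c) :- (b :+ d)) ≋-refl (F p q) (G p q) (sumOver F l) (sumOver G l))

⊛-sumOver : ∀ c (F : Family) l → c ⊛ sumOver F l ≋ sumOver (λ p q → c ⊛ F p q) l
⊛-sumOver c F []            = ⊛-zeroʳ c
⊛-sumOver c F ((p , q) ∷ l) = ≋-trans (⊛-distribˡ-⊕ c (F p q) (sumOver F l)) (⊕-congʳ (c ⊛ F p q) (⊛-sumOver c F l))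

sumOver-sumSeries : ∀ (s : ℕ → Family) l →
  sumOver (λ p q → sumSeries (λ k → s k p q)) l ≋ sumSeries (λ k → sumOver (s k) l)
sumOver-sumSeries s [] = ⟪ (λ n → trans (0ₛ-coeff n)
  (sym (trans (sumLt-cong (suc n) (λ k → 0ₛ-coeff n)) (sumLt-zero (suc n))))) ⟫
sumOver-sumSeries s ((p , q) ∷ l) = ≋-trans (⊕-congʳ (sumSeries (λ k → s k p q)) (sumOver-sumSeries s l))
  (≋-sym (sumSeries-⊕ (λ k → s k p q) (λ k → sumOver (s k) l)))

sumOver-order : ∀ {F : Family} {r} l → (∀ p q → F p q ∈O[z^ r ]) → sumOver F l ∈O[z^ r ]
sumOver-order []            F∈O = vanishing (λ m _ → 0ₛ-coeff m)
sumOver-order ((p , q) ∷ l) F∈O = O-⊕ (F∈O p q) (sumOver-order l F∈O)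

defect-cong : ∀ {F G : Family} → (∀ p q → F p q ≋ G p q) → ∀ i j → defect F i j ≋ defect G i j
defect-cong F≋G i j = ⊖-cong (F≋G i j) (⊛-congʳ zS (sumOver-cong (preds i j) F≋G))

originDefect-cong : ∀ {F G : Family} → (∀ p q → F p q ≋ G p q) → originDefect F ≋ originDefect G
originDefect-cong F≋G = ⊖-cong (defect-cong F≋G 0 0) (⊛-congʳ zS (F≋G 0 0))

defect-⊕ : ∀ (F G : Family) i j → defect (λ p q → F p q ⊕ G p q) i j ≋ defect F i j ⊕ defect G i j
defect-⊕ F G i j = ≋-trans (⊖-congʳ (F i j ⊕ G i j) (⊛-congʳ zS (sumOver-⊕ F G (preds i j))))
  (solve 5 (λ a b c d z → (a :+ b) :- z :* (c :+ d) := (a :- z :* c) :+ (b :- z :* d))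
           ≋-refl (F i j) (G i j) (predSum F i j) (predSum G i j) zS)

defect-⊖ : ∀ (F G : Family) i j → defect (λ p q → F p q ⊖ G p q) i j ≋ defect F i j ⊖ defect G i j
defect-⊖ F G i j = ≋-trans (⊖-congʳ (F i j ⊖ G i j) (⊛-congʳ zS (sumOver-⊖ F G (preds i j))))
  (solve 5 (λ a b c d z → (a :- b) :- z :* (c :- d) := (a :- z :* c) :- (b :- z :* d))
           ≋-refl (F i j) (G i j) (predSum F i j) (predSum G i j) zS)

originDefect-⊕ : ∀ (F G : Family) → originDefect (λ p q → F p q ⊕ G p q) ≋ originDefect F ⊕ originDefect G
originDefect-⊕ F G = ≋-trans (⊖-congˡ (zS ⊛ (F 0 0 ⊕ G 0 0)) (defect-⊕ F G 0 0))
  (solve 5 (λ a b c d z → (a :+ b) :- z :* (c :+ d) := (a :- z :* c) :+ (b :- z :* d))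
           ≋-refl (defect F 0 0) (defect G 0 0) (F 0 0) (G 0 0) zS)

originDefect-⊖ : ∀ (F G : Family) → originDefect (λ p q → F p q ⊖ G p q) ≋ originDefect F ⊖ originDefect G
originDefect-⊖ F G = ≋-trans (⊖-congˡ (zS ⊛ (F 0 0 ⊖ G 0 0)) (defect-⊖ F G 0 0))
  (solve 5 (λ a b c d z → (a :- b) :- z :* (c :- d) := (a :- z :* c) :- (b :- z :* d))
           ≋-refl (defect F 0 0) (defect G 0 0) (F 0 0) (G 0 0) zS)

productFamily : Series → Series → Family
productFamily x y i j = (one ⊖ x) ⊛ (one ⊖ y) ⊛ pow x i ⊛ pow y j

edgeDefect : Series → Series
edgeDefect x = x ⊖ zS ⊖ const 2ℚ ⊛ zS ⊛ x ⊛ x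

cornerDefect : Series → Series
cornerDefect x = const 2ℚ ⊛ zS ⊛ x ⊛ x ⊖ x

edgeTerm : ℕ → Series → Series
edgeTerm i x = (one ⊖ x) ⊛ pow x i ⊛ edgeDefect x

-- In each case the defect minus its claimed value is the kernel times a
-- polynomial in x, y, z, xⁱ, yʲ.
module ProductFamily (x y : Series) (K≋0 : kernel x y ≋ 0ₛ) where
  U = productFamily x y

  defect-interior : ∀ i j → defect U (suc i) (suc j) ≋ 0ₛ
  defect-interior i j = ≋-trans (solve 5 (λ x y X Y z →
      (con 1ℚ :- x) :* (con 1ℚ :- y) :* (x :* X) :* (y :* Y)
      :- z :* ((con 1ℚ :- x) :* (con 1ℚ :- y) :* X :* (y :* (y :* Y))
           :+ ((con 1ℚ :- x) :* (con 1ℚ :- y) :* (x :* (x :* X)) :* Y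
           :+ ((con 1ℚ :- x) :* (con 1ℚ :- y) :* (x :* (x :* X)) :* (y :* (y :* Y)) :+ con 0ℚ)))
      := (x :* y :- z :* (x :* x :+ y :* y :+ x :* x :* (y :* y))) :* ((con 1ℚ :- x) :* (con 1ℚ :- y) :* X :* Y))
      ≋-refl x y (pow x i) (pow y j) zS)
    (⊛-absorbˡ ((one ⊖ x) ⊛ (one ⊖ y) ⊛ pow x i ⊛ pow y j) K≋0)

  defect-row : ∀ i → defect U (suc i) 0 ≋ edgeTerm i x
  defect-row i = ⊖≋0⇒≋ (≋-trans (solve 4 (λ x y X z →
      ((con 1ℚ :- x) :* (con 1ℚ :- y) :* (x :* X) :* con 1ℚ
      :- z :* ((con 1ℚ :- x) :* (con 1ℚ :- y) :* X :* (y :* con 1ℚ)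
           :+ ((con 1ℚ :- x) :* (con 1ℚ :- y) :* (x :* (x :* X)) :* (y :* con 1ℚ)
           :+ ((con 1ℚ :- x) :* (con 1ℚ :- y) :* X :* con 1ℚ
           :+ ((con 1ℚ :- x) :* (con 1ℚ :- y) :* (x :* (x :* X)) :* con 1ℚ :+ con 0ℚ)))))
      :- (con 1ℚ :- x) :* X :* (x :- z :- con 2ℚ :* z :* x :* x)
      := (x :* y :- z :* (x :* x :+ y :* y :+ x :* x :* (y :* y))) :* (:- ((con 1ℚ :- x) :* X)))
      ≋-refl x y (pow x i) zS)
    (⊛-absorbˡ (neg ((one ⊖ x) ⊛ pow x i)) K≋0))

  defect-column : ∀ j → defect U 0 (suc j) ≋ edgeTerm j y
  defect-column j = ⊖≋0⇒≋ (≋-trans (solve 4 (λ x y Y z →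
      ((con 1ℚ :- x) :* (con 1ℚ :- y) :* con 1ℚ :* (y :* Y)
      :- z :* ((con 1ℚ :- x) :* (con 1ℚ :- y) :* (x :* con 1ℚ) :* Y
           :+ ((con 1ℚ :- x) :* (con 1ℚ :- y) :* (x :* con 1ℚ) :* (y :* (y :* Y))
           :+ ((con 1ℚ :- x) :* (con 1ℚ :- y) :* con 1ℚ :* Y
           :+ ((con 1ℚ :- x) :* (con 1ℚ :- y) :* con 1ℚ :* (y :* (y :* Y)) :+ con 0ℚ)))))
      :- (con 1ℚ :- y) :* Y :* (y :- z :- con 2ℚ :* z :* y :* y)
      := (x :* y :- z :* (x :* x :+ y :* y :+ x :* x :* (y :* y))) :* (:- ((con 1ℚ :- y) :* Y)))
      ≋-refl x y (pow y j) zS)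
    (⊛-absorbˡ (neg ((one ⊖ y) ⊛ pow y j)) K≋0))

  originDefect-U : originDefect U ≋ (one ⊖ zS) ⊕ cornerDefect x ⊕ cornerDefect y
  originDefect-U = ⊖≋0⇒≋ (≋-trans (solve 3 (λ x y z →
      ((con 1ℚ :- x) :* (con 1ℚ :- y) :* con 1ℚ :* con 1ℚ
      :- z :* ((con 1ℚ :- x) :* (con 1ℚ :- y) :* con 1ℚ :* (y :* con 1ℚ)
           :+ ((con 1ℚ :- x) :* (con 1ℚ :- y) :* (x :* con 1ℚ) :* (y :* con 1ℚ)
           :+ ((con 1ℚ :- x) :* (con 1ℚ :- y) :* (x :* con 1ℚ) :* con 1ℚ :+ con 0ℚ)))
      :- z :* ((con 1ℚ :- x) :* (con 1ℚ :- y) :* con 1ℚ :* con 1ℚ))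
      :- ((con 1ℚ :- z) :+ (con 2ℚ :* z :* x :* x :- x) :+ (con 2ℚ :* z :* y :* y :- y))
      := (x :* y :- z :* (x :* x :+ y :* y :+ x :* x :* (y :* y))) :* con 1ℚ)
      ≋-refl x y zS)
    (⊛-absorbˡ one K≋0))

module Summand (k : ℕ) where
  a = α k
  a′ = α (suc k)
  b = β k

  W : Family
  W i j = (productFamily a b i j ⊖ productFamily a′ b i j) ⊕ (productFamily b a i j ⊖ productFamily b a′ i j)

  rhsTerm≋W : ∀ i j → rhsTerm k i j ≋ W i j
  rhsTerm≋W i j = solve 9 (λ a a′ b Aᵢ A′ᵢ Bⱼ Bᵢ Aⱼ A′ⱼ →
     (con 1ℚ :- b) :* Bⱼ :* ((con 1ℚ :- a) :* Aᵢ :- (con 1ℚ :- a′) :* A′ᵢ)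
       :+ (con 1ℚ :- b) :* Bᵢ :* ((con 1ℚ :- a) :* Aⱼ :- (con 1ℚ :- a′) :* A′ⱼ)
     := ((con 1ℚ :- a) :* (con 1ℚ :- b) :* Aᵢ :* Bⱼ :- (con 1ℚ :- a′) :* (con 1ℚ :- b) :* A′ᵢ :* Bⱼ)
        :+ ((con 1ℚ :- b) :* (con 1ℚ :- a) :* Bᵢ :* Aⱼ :- (con 1ℚ :- b) :* (con 1ℚ :- a′) :* Bᵢ :* A′ⱼ))
     ≋-refl a a′ b (pow a i) (pow a′ i) (pow b j) (pow b i) (pow a j) (pow a′ j)

  module ab  = ProductFamily a b (kernel-α-β k)
  module a′b = ProductFamily a′ b (kernel-α′-β k)
  module ba  = ProductFamily b a (≋-trans (kernel-sym b a) (kernel-α-β k))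
  module ba′ = ProductFamily b a′ (≋-trans (kernel-sym b a′) (kernel-α′-β k))

  defect-W : ∀ i j → defect W i j ≋ (defect ab.U i j ⊖ defect a′b.U i j) ⊕ (defect ba.U i j ⊖ defect ba′.U i j)
  defect-W i j = ≋-trans (defect-⊕ (λ p q → ab.U p q ⊖ a′b.U p q) (λ p q → ba.U p q ⊖ ba′.U p q) i j)
                         (⊕-cong (defect-⊖ ab.U a′b.U i j) (defect-⊖ ba.U ba′.U i j))

  defect-interior : ∀ i j → defect W (suc i) (suc j) ≋ 0ₛ
  defect-interior i j = ≋-trans (defect-W (suc i) (suc j))
    (≋-trans (⊕-cong (⊖-cong (ab.defect-interior i j) (a′b.defect-interior i j))
                     (⊖-cong (ba.defect-interior i j) (ba′.defect-interior i j)))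
             ⟪ (λ { zero → refl ; (suc n) → refl }) ⟫)

  defect-row : ∀ i → defect W (suc i) 0 ≋ edgeTerm i a ⊖ edgeTerm i a′
  defect-row i = ≋-trans (defect-W (suc i) 0)
    (≋-trans (⊕-cong (⊖-cong (ab.defect-row i) (a′b.defect-row i)) (⊖-cong (ba.defect-row i) (ba′.defect-row i)))
             (solve 3 (λ p q r → (p :- q) :+ (r :- r) := p :- q) ≋-refl (edgeTerm i a) (edgeTerm i a′) (edgeTerm i b)))

  defect-column : ∀ j → defect W 0 (suc j) ≋ edgeTerm j a ⊖ edgeTerm j a′
  defect-column j = ≋-trans (defect-W 0 (suc j))
    (≋-trans (⊕-cong (⊖-cong (ab.defect-column j) (a′b.defect-column j))
                     (⊖-cong (ba.defect-column j) (ba′.defect-column j)))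
             (solve 3 (λ p q r → (r :- r) :+ (p :- q) := p :- q) ≋-refl (edgeTerm j a) (edgeTerm j a′) (edgeTerm j b)))

  originDefect-W : originDefect W ≋ const 2ℚ ⊛ (cornerDefect a ⊖ cornerDefect a′)
  originDefect-W = ≋-trans (originDefect-⊕ (λ p q → ab.U p q ⊖ a′b.U p q) (λ p q → ba.U p q ⊖ ba′.U p q))
    (≋-trans (⊕-cong (originDefect-⊖ ab.U a′b.U) (originDefect-⊖ ba.U ba′.U))
    (≋-trans (⊕-cong (⊖-cong ab.originDefect-U a′b.originDefect-U) (⊖-cong ba.originDefect-U ba′.originDefect-U))
      (solve 4 (λ z p p′ r → (((con 1ℚ :- z) :+ p :+ r) :- ((con 1ℚ :- z) :+ p′ :+ r))
                               :+ (((con 1ℚ :- z) :+ r :+ p) :- ((con 1ℚ :- z) :+ r :+ p′))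
                             := con 2ℚ :* (p :- p′)) ≋-refl zS (cornerDefect a) (cornerDefect a′) (cornerDefect b))))

xTerm-order : ∀ k i j → xTerm k i j ∈O[z^ suc k ]
xTerm-order k i j = O-⊛ʳ {(one ⊖ β k) ⊛ pow (β k) j} (bracket-order i)
  where
  a = α k
  a′ = α (suc k)
  a′∈O : a′ ∈O[z^ suc k ]
  a′∈O = O-weaken (ℕP.n≤1+n _) (α-order (suc k))
  bracket-order : ∀ i → (one ⊖ a) ⊛ pow a i ⊖ (one ⊖ a′) ⊛ pow a′ i ∈O[z^ suc k ]
  bracket-order zero = O-≋
    (solve 2 (λ a a′ → a′ :- a := (con 1ℚ :- a) :* con 1ℚ :- (con 1ℚ :- a′) :* con 1ℚ) ≋-refl a a′)
    (O-⊖ a′∈O (α-order k))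
  bracket-order (suc i) = O-⊖ (O-⊛ʳ {one ⊖ a} (O-⊛ˡ {a} {pow a i} (α-order k)))
                              (O-⊛ʳ {one ⊖ a′} (O-⊛ˡ {a′} {pow a′ i} a′∈O))

rhsTerm-order : ∀ k i j → rhsTerm k i j ∈O[z^ suc k ]
rhsTerm-order k i j = O-⊕ (xTerm-order k i j) (xTerm-order k j i)

rhsSum : Family
rhsSum i j = sumSeries (λ k → rhsTerm k i j)

rhsSum-≈[]-finSum : ∀ N i j → rhsSum i j ≈[ N ] finSum N (λ k → rhsTerm k i j)
rhsSum-≈[]-finSum N i j = sumSeries-≈[]-finSum (λ k → rhsTerm k i j) (λ k → rhsTerm-order k i j) N

predSum-rhsSum-≈[]-finSum : ∀ N i j → predSum rhsSum i j ≈[ N ] finSum N (λ k → predSum (rhsTerm k) i j)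
predSum-rhsSum-≈[]-finSum N i j = ≈[]-trans (≋⇒≈[] (sumOver-sumSeries rhsTerm (preds i j)))
  (sumSeries-≈[]-finSum (λ k → predSum (rhsTerm k) i j) (λ k → sumOver-order (preds i j) (rhsTerm-order k)) N)

defect-rhsSum-≈[] : ∀ N i j → defect rhsSum i j ≈[ N ] finSum N (λ k → defect (rhsTerm k) i j)
defect-rhsSum-≈[] N i j = ≈[]-trans
  (⊖-cong-≈[] (rhsSum-≈[]-finSum N i j) (⊛-congʳ-≈[] zS (predSum-rhsSum-≈[]-finSum N i j)))
  (≋⇒≈[] (≋-trans (⊖-congʳ (finSum N (λ k → rhsTerm k i j)) (⊛-finSum N zS (λ k → predSum (rhsTerm k) i j)))
                  (≋-sym (finSum-⊖ N (λ k → rhsTerm k i j) (λ k → zS ⊛ predSum (rhsTerm k) i j)))))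

originDefect-rhsSum-≈[] : ∀ N → originDefect rhsSum ≈[ N ] finSum N (λ k → originDefect (rhsTerm k))
originDefect-rhsSum-≈[] N = ≈[]-trans
  (⊖-cong-≈[] (defect-rhsSum-≈[] N 0 0) (⊛-congʳ-≈[] zS (rhsSum-≈[]-finSum N 0 0)))
  (≋⇒≈[] (≋-trans (⊖-congʳ (finSum N (λ k → defect (rhsTerm k) 0 0)) (⊛-finSum N zS (λ k → rhsTerm k 0 0)))
                  (≋-sym (finSum-⊖ N (λ k → defect (rhsTerm k) 0 0) (λ k → zS ⊛ rhsTerm k 0 0)))))

edgeDefect-α₀ : edgeDefect α₀ ≋ 0ₛ
edgeDefect-α₀ = ≋-trans
  (solve 2 (λ a z → a :- z :- con 2ℚ :* z :* a :* a := :- (con 2ℚ :* z :* a :* a :- a :+ z)) ≋-refl α₀ zS)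
  (≋-trans (neg-cong Kernel-α₀β₀.α₀-quadratic) ⟪ (λ { zero → refl ; (suc n) → refl }) ⟫)

cornerDefect-α₀ : cornerDefect α₀ ≋ neg zS
cornerDefect-α₀ = ≋-trans
  (solve 2 (λ a z → con 2ℚ :* z :* a :* a :- a := (con 2ℚ :* z :* a :* a :- a :+ z) :- z) ≋-refl α₀ zS)
  (≋-trans (⊖-congˡ zS Kernel-α₀β₀.α₀-quadratic) ⟪ (λ n → trans (cong (ℚ._- zS n) (0ₛ-coeff n)) (ℚP.+-identityˡ _)) ⟫)

δ₀ : ℕ → Series
δ₀ zero    = one
δ₀ (suc _) = 0ₛ

edgeTerm-α₀ : ∀ i → edgeTerm i α₀ ≋ 0ₛ
edgeTerm-α₀ i = ≋-trans (⊛-congʳ ((one ⊖ α₀) ⊛ pow α₀ i) edgeDefect-α₀) (⊛-zeroʳ ((one ⊖ α₀) ⊛ pow α₀ i))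

edgeTerm-α-≈[] : ∀ N i → edgeTerm i (α (suc N)) ≈[ N ] neg (zS ⊛ δ₀ i)
edgeTerm-α-≈[] N zero = ≈[]-trans
  (≋⇒≈[] (solve 2 (λ a z → (con 1ℚ :- a) :* con 1ℚ :* (a :- z :- con 2ℚ :* z :* a :* a)
                          := :- (z :* con 1ℚ) :+ a :* (con 1ℚ :- con 2ℚ :* z :* a :- a :+ z :+ con 2ℚ :* z :* a :* a))
                  ≋-refl a zS))
  (≈[]-trans (⊕-cong-≈[] (≈[]-refl {a = neg (zS ⊛ one)}) (O⇒≈[]0 (O-⊛ˡ {a} {R} a∈O)))
             (≋⇒≈[] (solve 1 (λ w → w :+ con 0ℚ := w) ≋-refl (neg (zS ⊛ one)))))
  where
  a = α (suc N)
  R = one ⊖ const 2ℚ ⊛ zS ⊛ a ⊖ a ⊕ zS ⊕ const 2ℚ ⊛ zS ⊛ a ⊛ a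
  a∈O : a ∈O[z^ suc N ]
  a∈O = O-weaken (ℕP.n≤1+n _) (α-order (suc N))
edgeTerm-α-≈[] N (suc i) = ≈[]-trans
  (O⇒≈[]0 (O-⊛ˡ {(one ⊖ a) ⊛ pow a (suc i)} {edgeDefect a} (O-⊛ʳ {one ⊖ a} (O-⊛ˡ {a} {pow a i} a∈O))))
  (≋⇒≈[] (solve 1 (λ z → con 0ℚ := :- (z :* con 0ℚ)) ≋-refl zS))
  where
  a = α (suc N)
  a∈O : a ∈O[z^ suc N ]
  a∈O = O-weaken (ℕP.n≤1+n _) (α-order (suc N))

edge-telescope : ∀ N i → finSum N (λ k → edgeTerm i (α k) ⊖ edgeTerm i (α (suc k))) ≈[ N ] zS ⊛ δ₀ i
edge-telescope N i = ≈[]-trans (≋⇒≈[] (finSum-telescope N (λ k → edgeTerm i (α k))))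
  (≈[]-trans (⊖-cong-≈[] (≋⇒≈[] (edgeTerm-α₀ i)) (edgeTerm-α-≈[] N i))
             (≋⇒≈[] (solve 1 (λ w → con 0ℚ :- (:- w) := w) ≋-refl (zS ⊛ δ₀ i))))

defect-rhsSum-interior : ∀ i j → defect rhsSum (suc i) (suc j) ≋ 0ₛ
defect-rhsSum-interior i j = ≈[]⇒≋ (λ N → ≈[]-trans (defect-rhsSum-≈[] N (suc i) (suc j))
  (≋⇒≈[] (≋-trans (finSum-cong N (λ k → ≋-trans (defect-cong (Summand.rhsTerm≋W k) (suc i) (suc j))
                                                 (Summand.defect-interior k i j)))
                  (finSum-zero N))))

defect-rhsSum-row : ∀ i → defect rhsSum (suc i) 0 ≋ zS ⊛ δ₀ i
defect-rhsSum-row i = ≈[]⇒≋ (λ N → ≈[]-trans (defect-rhsSum-≈[] N (suc i) 0)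
  (≈[]-trans (≋⇒≈[] (finSum-cong N (λ k → ≋-trans (defect-cong (Summand.rhsTerm≋W k) (suc i) 0)
                                                  (Summand.defect-row k i))))
             (edge-telescope N i)))

defect-rhsSum-column : ∀ j → defect rhsSum 0 (suc j) ≋ zS ⊛ δ₀ j
defect-rhsSum-column j = ≈[]⇒≋ (λ N → ≈[]-trans (defect-rhsSum-≈[] N 0 (suc j))
  (≈[]-trans (≋⇒≈[] (finSum-cong N (λ k → ≋-trans (defect-cong (Summand.rhsTerm≋W k) 0 (suc j))
                                                  (Summand.defect-column k j))))
             (edge-telescope N j)))

originDefect-rhsSum : originDefect rhsSum ≋ neg (const 2ℚ ⊛ zS)
originDefect-rhsSum = ≈[]⇒≋ (λ N → ≈[]-trans (originDefect-rhsSum-≈[] N)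
  (≈[]-trans (≋⇒≈[] (≋-trans (finSum-cong N (λ k → ≋-trans (originDefect-cong (Summand.rhsTerm≋W k))
                                                            (Summand.originDefect-W k)))
                    (≋-trans (≋-sym (⊛-finSum N (const 2ℚ) (λ k → cornerDefect (α k) ⊖ cornerDefect (α (suc k)))))
                             (⊛-congʳ (const 2ℚ) (finSum-telescope N (λ k → cornerDefect (α k)))))))
  (≈[]-trans (⊛-congʳ-≈[] (const 2ℚ) (⊖-cong-≈[] (≋⇒≈[] cornerDefect-α₀) (O⇒≈[]0 (corner-order N))))
             (≋⇒≈[] (solve 1 (λ z → con 2ℚ :* (:- z :- con 0ℚ) := :- (con 2ℚ :* z)) ≋-refl zS)))))
  where
  corner-order : ∀ N → cornerDefect (α (suc N)) ∈O[z^ suc N ]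
  corner-order N = O-⊖ (O-⊛ˡ {const 2ℚ ⊛ zS ⊛ a} {a} (O-⊛ʳ {const 2ℚ ⊛ zS} {a} a∈O)) a∈O
    where
    a = α (suc N)
    a∈O : a ∈O[z^ suc N ]
    a∈O = O-weaken (ℕP.n≤1+n _) (α-order (suc N))

-- The candidate satisfies the recursion of q

T : Family
T i j = δ00 i j ⊕ rhsSum i j

candidate : Family
candidate i j = c ⊛ T i j

nextToOrigin : ℕ → ℕ → Series
nextToOrigin (suc i) (suc j) = 0ₛ
nextToOrigin (suc i) zero    = δ₀ i
nextToOrigin zero    (suc j) = δ₀ j
nextToOrigin zero    zero    = 0ₛ

predSum-δ00 : ∀ i j → predSum δ00 i j ≋ nextToOrigin i j
predSum-δ00 (suc zero)    (suc j) = ⟪ (λ { zero → refl ; (suc n) → refl }) ⟫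
predSum-δ00 (suc (suc i)) (suc j) = ⟪ (λ { zero → refl ; (suc n) → refl }) ⟫
predSum-δ00 (suc zero)    zero    = ⟪ (λ { zero → refl ; (suc n) → refl }) ⟫
predSum-δ00 (suc (suc i)) zero    = ⟪ (λ { zero → refl ; (suc n) → refl }) ⟫
predSum-δ00 zero    (suc zero)    = ⟪ (λ { zero → refl ; (suc n) → refl }) ⟫
predSum-δ00 zero    (suc (suc j)) = ⟪ (λ { zero → refl ; (suc n) → refl }) ⟫
predSum-δ00 zero    zero          = ⟪ (λ { zero → refl ; (suc n) → refl }) ⟫

predSum-T : ∀ i j → predSum T i j ≋ nextToOrigin i j ⊕ predSum rhsSum i j
predSum-T i j = ≋-trans (sumOver-⊕ δ00 rhsSum (preds i j)) (⊕-congˡ (predSum rhsSum i j) (predSum-δ00 i j))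

denominator : Series
denominator = one ⊖ const 2ℚ ⊛ zS ⊕ zS ⊛ x̂ 0 0

c⊛denominator : c ⊛ denominator ≋ one
c⊛denominator = ≋-trans (⊛-comm c denominator) (⊛-inv denominator (λ eq → 1≢0 (trans (sym denominator₀≡1) eq)))
  where
  denominator₀≡1 : denominator 0 ≡ 1ℚ
  denominator₀≡1 = cong₂ (λ p r → (1ℚ ℚ.- p) ℚ.+ r) (const-⊛-coeff 2ℚ zS 0) (z⊛-coeff-zero (x̂ 0 0))

T-recursion-off-origin : ∀ i j → δ00 i j ≋ 0ₛ → defect rhsSum i j ≋ zS ⊛ nextToOrigin i j →
  T i j ≋ denominator ⊛ δ00 i j ⊕ zS ⊛ predSum T i j
T-recursion-off-origin i j δ≋0 defect≋ = begin
  δ00 i j ⊕ X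
    ≈⟨ solve 5 (λ δ x n w z → δ :+ x := δ :* (con 1ℚ :- w) :+ w :* δ :+ (x :- z :* n) :+ z :* n)
               ≋-refl (δ00 i j) X N denominator zS ⟩
  δ00 i j ⊛ (one ⊖ denominator) ⊕ denominator ⊛ δ00 i j ⊕ defect rhsSum i j ⊕ zS ⊛ N
    ≈⟨ ⊕-congˡ (zS ⊛ N) (⊕-cong (⊕-congˡ (denominator ⊛ δ00 i j) (⊛-absorbˡ (one ⊖ denominator) δ≋0)) defect≋) ⟩
  0ₛ ⊕ denominator ⊛ δ00 i j ⊕ zS ⊛ nextToOrigin i j ⊕ zS ⊛ N
    ≈⟨ solve 4 (λ e d z n → con 0ℚ :+ e :+ z :* d :+ z :* n := e :+ z :* (d :+ n))
               ≋-refl (denominator ⊛ δ00 i j) (nextToOrigin i j) zS N ⟩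
  denominator ⊛ δ00 i j ⊕ zS ⊛ (nextToOrigin i j ⊕ N)
    ≈⟨ ⊕-congʳ (denominator ⊛ δ00 i j) (⊛-congʳ zS (≋-sym (predSum-T i j))) ⟩
  denominator ⊛ δ00 i j ⊕ zS ⊛ predSum T i j ∎
  where
  open ≋-Reasoning
  X = rhsSum i j
  N = predSum rhsSum i j

rhsSum₀₀≋x̂₀₀ : rhsSum 0 0 ≋ x̂ 0 0
rhsSum₀₀≋x̂₀₀ = sumSeries-⊕ (λ k → xTerm k 0 0) (λ k → xTerm k 0 0)

T-recursion-origin : T 0 0 ≋ denominator ⊛ one ⊕ zS ⊛ predSum T 0 0
T-recursion-origin = begin
  one ⊕ X
    ≈⟨ solve 3 (λ x n z → con 1ℚ :+ x
                 := (con 1ℚ :- con 2ℚ :* z :+ z :* x) :+ z :* (con 0ℚ :+ n) :+ (((x :- z :* n) :- z :* x) :+ con 2ℚ :* z))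
               ≋-refl X (predSum rhsSum 0 0) zS ⟩
  (one ⊖ const 2ℚ ⊛ zS ⊕ zS ⊛ X) ⊕ zS ⊛ (0ₛ ⊕ predSum rhsSum 0 0) ⊕ (originDefect rhsSum ⊕ const 2ℚ ⊛ zS)
    ≈⟨ ⊕-cong (⊕-cong (⊕-congʳ (one ⊖ const 2ℚ ⊛ zS) (⊛-congʳ zS rhsSum₀₀≋x̂₀₀)) (⊛-congʳ zS (≋-sym (predSum-T 0 0))))
              (⊕-congˡ (const 2ℚ ⊛ zS) originDefect-rhsSum) ⟩
  denominator ⊕ zS ⊛ predSum T 0 0 ⊕ (neg (const 2ℚ ⊛ zS) ⊕ const 2ℚ ⊛ zS)
    ≈⟨ solve 3 (λ d p w → d :+ p :+ (:- w :+ w) := d :* con 1ℚ :+ p) ≋-refl denominator (zS ⊛ predSum T 0 0) (const 2ℚ ⊛ zS) ⟩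
  denominator ⊛ one ⊕ zS ⊛ predSum T 0 0 ∎
  where
  open ≋-Reasoning
  X = rhsSum 0 0

T-recursion : ∀ i j → T i j ≋ denominator ⊛ δ00 i j ⊕ zS ⊛ predSum T i j
T-recursion zero    zero    = T-recursion-origin
T-recursion (suc i) (suc j) =
  T-recursion-off-origin (suc i) (suc j) ≋-refl (≋-trans (defect-rhsSum-interior i j) (≋-sym (⊛-zeroʳ zS)))
T-recursion (suc i) zero    = T-recursion-off-origin (suc i) zero ≋-refl (defect-rhsSum-row i)
T-recursion zero    (suc j) = T-recursion-off-origin zero (suc j) ≋-refl (defect-rhsSum-column j)

candidate-recursion : ∀ i j → candidate i j ≋ δ00 i j ⊕ zS ⊛ predSum candidate i j
candidate-recursion i j = begin
  c ⊛ T i j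
    ≈⟨ ⊛-congʳ c (T-recursion i j) ⟩
  c ⊛ (denominator ⊛ δ00 i j ⊕ zS ⊛ predSum T i j)
    ≈⟨ solve 5 (λ c w δ z n → c :* (w :* δ :+ z :* n) := (c :* w) :* δ :+ z :* (c :* n))
               ≋-refl c denominator (δ00 i j) zS (predSum T i j) ⟩
  (c ⊛ denominator) ⊛ δ00 i j ⊕ zS ⊛ (c ⊛ predSum T i j)
    ≈⟨ ⊕-cong (≋-trans (⊛-congˡ (δ00 i j) c⊛denominator) (one-⊛ (δ00 i j))) (⊛-congʳ zS (⊛-sumOver c T (preds i j))) ⟩
  δ00 i j ⊕ zS ⊛ predSum candidate i j ∎
  where open ≋-Reasoning

candidate-coeff-zero : ∀ i j → candidate i j 0 ≡ δ00 i j 0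
candidate-coeff-zero i j = trans (ap (candidate-recursion i j) 0)
  (trans (cong (δ00 i j 0 ℚ.+_) (z⊛-coeff-zero (predSum candidate i j))) (ℚP.+-identityʳ _))

candidate-coeff-suc : ∀ i j n → candidate i j (suc n) ≡ predSum candidate i j n
candidate-coeff-suc i j n = trans (ap (candidate-recursion i j) (suc n))
  (trans (cong₂ ℚ._+_ (δ00-coeff-suc i j) (z⊛-coeff-suc (predSum candidate i j) n)) (ℚP.+-identityˡ _))
  where
  δ00-coeff-suc : ∀ i j → δ00 i j (suc n) ≡ 0ℚ
  δ00-coeff-suc zero    zero    = refl
  δ00-coeff-suc zero    (suc j) = refl
  δ00-coeff-suc (suc i) j       = refl

ι : ℕ → ℚ
ι m = + m ℚ./ 1

ι≡mkℚ : ∀ m → ι m ≡ mkℚ (+ m) 0 (Coprime.sym (Coprime.1-coprimeTo m))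
ι≡mkℚ m = ℚP.normalize-coprime (Coprime.sym (Coprime.1-coprimeTo m))

ι-+ : ∀ m k → ι (m ℕ.+ k) ≡ ι m ℚ.+ ι k
ι-+ m k rewrite ι≡mkℚ m | ι≡mkℚ k =
  cong₂ (λ a b → (a ℤ.+ b) ℚ./ 1) (sym (ℤP.*-identityʳ (+ m))) (sym (ℤP.*-identityʳ (+ k)))

ι-+₃ : ∀ n a b d → ι ((a ℕ.+ b) ℕ.+ d) ≡ ι a ℚ.+ (ι b ℚ.+ (ι d ℚ.+ 0ₛ n))
ι-+₃ n a b d = begin
  ι ((a ℕ.+ b) ℕ.+ d)                        ≡⟨ trans (ι-+ (a ℕ.+ b) d) (cong (ℚ._+ ι d) (ι-+ a b)) ⟩
  (ι a ℚ.+ ι b) ℚ.+ ι d                      ≡⟨ ℚS.solve 3 (λ a b d → (a ℚS.:+ b) ℚS.:+ d ℚS.:= a ℚS.:+ (b ℚS.:+ (d ℚS.:+ ℚS.con 0ℚ)))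
                                                           refl (ι a) (ι b) (ι d) ⟩
  ι a ℚ.+ (ι b ℚ.+ (ι d ℚ.+ 0ℚ))             ≡⟨ cong (λ t → ι a ℚ.+ (ι b ℚ.+ (ι d ℚ.+ t))) (sym (0ₛ-coeff n)) ⟩
  ι a ℚ.+ (ι b ℚ.+ (ι d ℚ.+ 0ₛ n))           ∎
  where open ≡-Reasoning

ι-+₄ : ∀ n a b d e → ι (((a ℕ.+ b) ℕ.+ d) ℕ.+ e) ≡ ι a ℚ.+ (ι b ℚ.+ (ι d ℚ.+ (ι e ℚ.+ 0ₛ n)))
ι-+₄ n a b d e = begin
  ι (((a ℕ.+ b) ℕ.+ d) ℕ.+ e)                ≡⟨ trans (ι-+ ((a ℕ.+ b) ℕ.+ d) e)
                                                  (cong (ℚ._+ ι e) (trans (ι-+ (a ℕ.+ b) d) (cong (ℚ._+ ι d) (ι-+ a b)))) ⟩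
  ((ι a ℚ.+ ι b) ℚ.+ ι d) ℚ.+ ι e            ≡⟨ ℚS.solve 4 (λ a b d e → ((a ℚS.:+ b) ℚS.:+ d) ℚS.:+ e ℚS.:= a ℚS.:+ (b ℚS.:+ (d ℚS.:+ (e ℚS.:+ ℚS.con 0ℚ))))
                                                           refl (ι a) (ι b) (ι d) (ι e) ⟩
  ι a ℚ.+ (ι b ℚ.+ (ι d ℚ.+ (ι e ℚ.+ 0ℚ)))   ≡⟨ cong (λ t → ι a ℚ.+ (ι b ℚ.+ (ι d ℚ.+ (ι e ℚ.+ t)))) (sym (0ₛ-coeff n)) ⟩
  ι a ℚ.+ (ι b ℚ.+ (ι d ℚ.+ (ι e ℚ.+ 0ₛ n))) ∎
  where open ≡-Reasoning

qS-coeff-suc : ∀ i j n → qS i j (suc n) ≡ predSum qS i j n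
qS-coeff-suc (suc i) (suc j) n = ι-+₃ n (q i (suc (suc j)) n) (q (suc (suc i)) j n) (q (suc (suc i)) (suc (suc j)) n)
qS-coeff-suc (suc i) zero    n = ι-+₄ n (q i 1 n) (q (suc (suc i)) 1 n) (q i 0 n) (q (suc (suc i)) 0 n)
qS-coeff-suc zero    (suc j) n = ι-+₄ n (q 1 j n) (q 1 (suc (suc j)) n) (q 0 j n) (q 0 (suc (suc j)) n)
qS-coeff-suc zero    zero    n = ι-+₃ n (q 0 1 n) (q 1 1 n) (q 1 0 n)

qS-coeff-zero : ∀ i j → qS i j 0 ≡ δ00 i j 0
qS-coeff-zero zero    zero    = refl
qS-coeff-zero zero    (suc j) = refl
qS-coeff-zero (suc i) j       = refl

qS-coeff≡candidate : ∀ n i j → qS i j n ≡ candidate i j n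
qS-coeff≡candidate zero    i j = trans (qS-coeff-zero i j) (sym (candidate-coeff-zero i j))
qS-coeff≡candidate (suc n) i j = begin
  qS i j (suc n)              ≡⟨ qS-coeff-suc i j n ⟩
  predSum qS i j n            ≡⟨ sumOver-coeff n (preds i j) (qS-coeff≡candidate n) ⟩
  predSum candidate i j n     ≡⟨ sym (candidate-coeff-suc i j n) ⟩
  candidate i j (suc n)       ∎
  where open ≡-Reasoning

qS≈candidate : ∀ i j → qS i j ≈ c ⊛ (δ00 i j ⊕ sumSeries (λ k → rhsTerm k i j))
qS≈candidate i j n = qS-coeff≡candidate n i j

⊛-coeff-≈[] : ∀ a {n b b′} → b ≈[ n ] b′ → (a ⊛ b) n ≡ (a ⊛ b′) n
⊛-coeff-≈[] a {n} b≈b′ = agree (⊛-congʳ-≈[] a b≈b′) n ℕP.≤-refl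

geometricSum : ℕ → Series → Series
geometricSum n x = finSum n (pow x)

geometric-sum : ∀ n x → (one ⊖ x) ⊛ geometricSum n x ≋ one ⊖ pow x (suc n)
geometric-sum zero    x = ≋-trans (⊛-congʳ (one ⊖ x) ⟪ (λ m → ℚP.+-identityˡ (one m)) ⟫)
  (solve 1 (λ x → (con 1ℚ :- x) :* con 1ℚ := con 1ℚ :- x :* con 1ℚ) ≋-refl x)
geometric-sum (suc n) x = ≋-trans (⊛-distribˡ-⊕ (one ⊖ x) (geometricSum n x) (pow x (suc n)))
  (≋-trans (⊕-congˡ ((one ⊖ x) ⊛ pow x (suc n)) (geometric-sum n x))
    (solve 2 (λ x P → (con 1ℚ :- x :* P) :+ (con 1ℚ :- x) :* (x :* P) := con 1ℚ :- x :* (x :* P)) ≋-refl x (pow x n)))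

geometric-sum-≈[] : ∀ n x → x ∈O[z^ 1 ] → (one ⊖ x) ⊛ geometricSum n x ≈[ n ] one
geometric-sum-≈[] n x x∈O = ≈[]-trans (≋⇒≈[] (geometric-sum n x)) (one⊖O≈[]one (O-pow (suc n) x∈O))

rowSum-productFamily : ∀ n x y → x ∈O[z^ 1 ] → finSum n (λ i → productFamily x y i 0) ≈[ n ] one ⊖ y
rowSum-productFamily n x y x∈O = ≈[]-trans
  (≋⇒≈[] (≋-trans (finSum-cong n (λ i → solve 3 (λ x y P → (con 1ℚ :- x) :* (con 1ℚ :- y) :* P :* con 1ℚ
                                                       := ((con 1ℚ :- y) :* (con 1ℚ :- x)) :* P) ≋-refl x y (pow x i)))
          (≋-trans (≋-sym (⊛-finSum n ((one ⊖ y) ⊛ (one ⊖ x)) (pow x))) (⊛-assoc (one ⊖ y) (one ⊖ x) (geometricSum n x)))))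
  (≈[]-trans (⊛-congʳ-≈[] (one ⊖ y) (geometric-sum-≈[] n x x∈O)) (≋⇒≈[] (⊛-one (one ⊖ y))))

doubleSum : ℕ → Family → Series
doubleSum n F = finSum n (λ i → finSum n (F i))

doubleSum-⊕ : ∀ n (F G : Family) → doubleSum n (λ i j → F i j ⊕ G i j) ≋ doubleSum n F ⊕ doubleSum n G
doubleSum-⊕ n F G = ≋-trans (finSum-cong n (λ i → finSum-⊕ n (F i) (G i))) (finSum-⊕ n (λ i → finSum n (F i)) (λ i → finSum n (G i)))

doubleSum-⊖ : ∀ n (F G : Family) → doubleSum n (λ i j → F i j ⊖ G i j) ≋ doubleSum n F ⊖ doubleSum n G
doubleSum-⊖ n F G = ≋-trans (finSum-cong n (λ i → finSum-⊖ n (F i) (G i))) (finSum-⊖ n (λ i → finSum n (F i)) (λ i → finSum n (G i)))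

doubleSum-productFamily : ∀ n x y → x ∈O[z^ 1 ] → y ∈O[z^ 1 ] → doubleSum n (productFamily x y) ≈[ n ] one
doubleSum-productFamily n x y x∈O y∈O = ≈[]-trans (≋⇒≈[] separate)
  (≈[]-trans (⊛-cong-≈[] (geometric-sum-≈[] n x x∈O) (geometric-sum-≈[] n y y∈O)) (≋⇒≈[] (⊛-one one)))
  where
  separate : doubleSum n (productFamily x y) ≋ ((one ⊖ x) ⊛ geometricSum n x) ⊛ ((one ⊖ y) ⊛ geometricSum n y)
  separate = ≋-trans (finSum-cong n (λ i → ≋-sym (⊛-finSum n ((one ⊖ x) ⊛ (one ⊖ y) ⊛ pow x i) (pow y))))
    (≋-trans (≋-sym (finSum-⊛ n (λ i → (one ⊖ x) ⊛ (one ⊖ y) ⊛ pow x i) (geometricSum n y)))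
    (≋-trans (⊛-congˡ (geometricSum n y) (≋-sym (⊛-finSum n ((one ⊖ x) ⊛ (one ⊖ y)) (pow x))))
    (solve 4 (λ x y gx gy → (con 1ℚ :- x) :* (con 1ℚ :- y) :* gx :* gy := ((con 1ℚ :- x) :* gx) :* ((con 1ℚ :- y) :* gy))
             ≋-refl x y (geometricSum n x) (geometricSum n y))))

module SummandSums (k : ℕ) (n : ℕ) where
  open Summand k

  rowSum-W : finSum n (λ i → W i 0) ≈[ n ] a′ ⊖ a
  rowSum-W = ≈[]-trans
    (≋⇒≈[] (≋-trans (finSum-⊕ n (λ i → ab.U i 0 ⊖ a′b.U i 0) (λ i → ba.U i 0 ⊖ ba′.U i 0))
                    (⊕-cong (finSum-⊖ n (λ i → ab.U i 0) (λ i → a′b.U i 0)) (finSum-⊖ n (λ i → ba.U i 0) (λ i → ba′.U i 0)))))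
    (≈[]-trans (⊕-cong-≈[] (⊖-cong-≈[] (rowSum-productFamily n a b (α-order₁ k)) (rowSum-productFamily n a′ b (α-order₁ (suc k))))
                           (⊖-cong-≈[] (rowSum-productFamily n b a (β-order₁ k)) (rowSum-productFamily n b a′ (β-order₁ k))))
      (≋⇒≈[] (solve 3 (λ a a′ b → ((con 1ℚ :- b) :- (con 1ℚ :- b)) :+ ((con 1ℚ :- a) :- (con 1ℚ :- a′)) := a′ :- a)
                      ≋-refl a a′ b)))

  doubleSum-W : doubleSum n W ≈[ n ] 0ₛ
  doubleSum-W = ≈[]-trans
    (≋⇒≈[] (≋-trans (doubleSum-⊕ n (λ i j → ab.U i j ⊖ a′b.U i j) (λ i j → ba.U i j ⊖ ba′.U i j))
                    (⊕-cong (doubleSum-⊖ n ab.U a′b.U) (doubleSum-⊖ n ba.U ba′.U))))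
    (≈[]-trans (⊕-cong-≈[] (⊖-cong-≈[] (doubleSum-productFamily n a b (α-order₁ k) (β-order₁ k))
                                       (doubleSum-productFamily n a′ b (α-order₁ (suc k)) (β-order₁ k)))
                           (⊖-cong-≈[] (doubleSum-productFamily n b a (β-order₁ k) (α-order₁ k))
                                       (doubleSum-productFamily n b a′ (β-order₁ k) (α-order₁ (suc k)))))
      (≋⇒≈[] ⟪ (λ { zero → refl ; (suc m) → refl }) ⟫))

rowSum-rhsSum : ∀ n → finSum n (λ i → rhsSum i 0) ≈[ n ] neg α₀
rowSum-rhsSum n = ≈[]-trans (finSum-cong-≈[] n (λ i → rhsSum-≈[]-finSum n i 0))
  (≈[]-trans (≋⇒≈[] (≋-trans (finSum-swap n n (λ k i → rhsTerm k i 0))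
                             (finSum-cong n (λ k → finSum-cong n (λ i → Summand.rhsTerm≋W k i 0)))))
  (≈[]-trans (finSum-cong-≈[] n (λ k → SummandSums.rowSum-W k n))
  (≈[]-trans (≋⇒≈[] (≋-trans (finSum-cong n (λ k → solve 2 (λ p q → q :- p := (:- p) :- (:- q)) ≋-refl (α k) (α (suc k))))
                             (finSum-telescope n (λ k → neg (α k)))))
  (≈[]-trans (⊖-cong-≈[] (≈[]-refl {a = neg α₀}) (O⇒≈[]0 (O-neg (O-weaken (ℕP.n≤1+n (suc n)) (α-order (suc n))))))
             (≋⇒≈[] (solve 1 (λ a → a :- con 0ℚ := a) ≋-refl (neg α₀)))))))

doubleSum-rhsSum : ∀ n → doubleSum n rhsSum ≈[ n ] 0ₛ
doubleSum-rhsSum n = ≈[]-trans (finSum-cong-≈[] n (λ i → finSum-cong-≈[] n (λ j → rhsSum-≈[]-finSum n i j)))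
  (≈[]-trans (≋⇒≈[] (≋-trans (finSum-cong n (λ i → finSum-swap n n (λ k j → rhsTerm k i j)))
                    (≋-trans (finSum-swap n n (λ k i → finSum n (λ j → rhsTerm k i j)))
                             (finSum-cong n (λ k → finSum-cong n (λ i → finSum-cong n (λ j → Summand.rhsTerm≋W k i j)))))))
  (≈[]-trans (finSum-cong-≈[] n (λ k → SummandSums.doubleSum-W k n)) (≋⇒≈[] (finSum-zero n))))

rowSum-T : ∀ n → finSum n (λ i → T i 0) ≈[ n ] one ⊖ α₀
rowSum-T n = ≈[]-trans (≋⇒≈[] (finSum-⊕ n (λ i → δ00 i 0) (λ i → rhsSum i 0)))
  (≈[]-trans (⊕-cong-≈[] (≋⇒≈[] (finSum-head n (λ i → δ00 i 0) (λ _ → ≋-refl))) (rowSum-rhsSum n))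
             (≋⇒≈[] (solve 1 (λ a → con 1ℚ :+ :- a := con 1ℚ :- a) ≋-refl α₀)))

doubleSum-T : ∀ n → doubleSum n T ≈[ n ] one
doubleSum-T n = ≈[]-trans (≋⇒≈[] (doubleSum-⊕ n δ00 rhsSum))
  (≈[]-trans (⊕-cong-≈[] (≋⇒≈[] doubleSum-δ00) (doubleSum-rhsSum n))
             (≋⇒≈[] (solve 0 (con 1ℚ :+ con 0ℚ := con 1ℚ) ≋-refl)))
  where
  doubleSum-δ00 : doubleSum n δ00 ≋ one
  doubleSum-δ00 = ≋-trans (finSum-head n (λ i → finSum n (δ00 i)) (λ i → finSum-zero n))
                          (finSum-head n (δ00 0) (λ _ → ≋-refl))

T-transpose : ∀ j → T 0 j ≋ T j 0
T-transpose zero    = ≋-refl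
T-transpose (suc j) = ⊕-congʳ 0ₛ (sumSeries-cong (λ k → ⟪ (λ m → ℚP.+-comm (xTerm k 0 (suc j) m) (xTerm k (suc j) 0 m)) ⟫))

Q00≈ : qS 0 0 ≈ c ⊛ (one ⊕ x̂ 0 0)
Q00≈ n = trans (qS≈candidate 0 0 n) (ap (⊛-congʳ c (⊕-congʳ one rhsSum₀₀≋x̂₀₀)) n)

Q10≈ : Q10 ≈ c ⊛ (one ⊖ α 0)
Q10≈ n = begin
  Q10 n                                  ≡⟨ sumLt-cong (suc n) (λ i → qS-coeff≡candidate n i 0) ⟩
  finSum n (λ i → candidate i 0) n       ≡⟨ sym (ap (⊛-finSum n c (λ i → T i 0)) n) ⟩
  (c ⊛ finSum n (λ i → T i 0)) n         ≡⟨ ⊛-coeff-≈[] c (rowSum-T n) ⟩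
  (c ⊛ (one ⊖ α₀)) n                     ∎
  where open ≡-Reasoning

Q01≈ : Q01 ≈ c ⊛ (one ⊖ α 0)
Q01≈ n = trans (sumLt-cong (suc n) (λ j → begin
  qS 0 j n              ≡⟨ qS-coeff≡candidate n 0 j ⟩
  candidate 0 j n       ≡⟨ ap (⊛-congʳ c (T-transpose j)) n ⟩
  candidate j 0 n       ≡⟨ sym (qS-coeff≡candidate n j 0) ⟩
  qS j 0 n              ∎)) (Q10≈ n)
  where open ≡-Reasoning

Q11≈ : Q11 ≈ c
Q11≈ n = begin
  Q11 n                                  ≡⟨ sumLt-cong (suc n) (λ i → sumLt-cong (suc n) (λ j → qS-coeff≡candidate n i j)) ⟩
  doubleSum n candidate n                ≡⟨ sym (ap (≋-trans (⊛-finSum n c (λ i → finSum n (T i)))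
                                                            (finSum-cong n (λ i → ⊛-finSum n c (T i)))) n) ⟩
  (c ⊛ doubleSum n T) n                  ≡⟨ ⊛-coeff-≈[] c (doubleSum-T n) ⟩
  (c ⊛ one) n                            ≡⟨ ap (⊛-one c) n ⟩
  c n                                    ∎
  where open ≡-Reasoning

proposition6 :
    (∀ i j → qS i j ≈ c ⊛ (δ00 i j ⊕ sumSeries (λ k → rhsTerm k i j)))
    × (qS 0 0 ≈ c ⊛ (one ⊕ x̂ 0 0))
    × (Q10 ≈ c ⊛ (one ⊖ α 0))
    × (Q01 ≈ c ⊛ (one ⊖ α 0))
    × (Q11 ≈ c)
proposition6 = qS≈candidate , Q00≈ , Q10≈ , Q01≈ , Q11≈
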